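{- Let $D$ be the derivation of $\mathbb{Q}[w,x,y]$ determined by $D(w)=w+wx$, $D(x)=x+xy$, $D(y)=y+x^2$, and for $n\ge 0$ write $D^n(w)=w\sum_{i,j\ge0}t_{n,i,j}x^iy^j$. Then for all $n\ge 1$, $i\ge 1$ and $j\ge 0$, $t_{n,i,j}$ is the number of cyclically ordered partitions of $\{1,\dots,n+1\}$ with $i+j+1$ blocks such that the length of the longest alternating subsequence of the list of openers equals $i$.
   Context: A derivation is a linear map satisfying $D(fg)=D(f)g+fD(g)$. A cyclically ordered partition of $\{1,\dots,m\}$ is a set partition of $\{1,\dots,m\}$ whose blocks are endowed with a cyclic order; it is represented canonically as a list of blocks in which the first block contains $1$ (the other blocks following in the cyclic order) and each block is an increasing list. The opener of a block is its least element; the list of openers is the list of openers of the blocks in canonical order. An alternating subsequence of a list $w_1\cdots w_r$ of distinct integers is a subsequence $w_{i_1}\cdots w_{i_k}$ ($i_1<\dots<i_k$) with $w_{i_1}>w_{i_2}<w_{i_3}>\cdots$. -}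

module Defs where

open import Data.Bool using (Bool; true; false; _∧_; _∨_; not; if_then_else_)
open import Data.Nat using (ℕ; zero; suc; _∸_; _≡ᵇ_; _<ᵇ_; _⊔_)
open import Data.Fin using (Fin; toℕ)
open import Data.List using (List; []; _∷_; _++_; map; concatMap; filterᵇ; length; foldr)
open import Data.Bool.ListAction using (and; or)
open import Data.Vec using (Vec; lookup) renaming ([] to []ᵥ; _∷_ to _∷ᵥ_)
open import Data.List.Base using (allFin)
open import Data.Integer using (+_)
open import Data.Rational using (ℚ; 0ℚ; 1ℚ; _+_; _*_; _/_)

-- Polynomials in Q[w,x,y], represented by their coefficient function:
-- p a b c = coefficient of w^a x^b y^c.

Poly : Set
Poly = ℕ → ℕ → ℕ → ℚ

ℕtoℚ : ℕ → ℚ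
ℕtoℚ n = (+ n) / 1

_⊕_ : Poly → Poly → Poly
(p ⊕ q) a b c = p a b c + q a b c

mulMon : ℕ → ℕ → ℕ → Poly → Poly
mulMon e f g p a b c =
  if (a <ᵇ e) ∨ (b <ᵇ f) ∨ (c <ᵇ g) then 0ℚ else p (a ∸ e) (b ∸ f) (c ∸ g)

∂w ∂x ∂y : Poly → Poly
∂w p a b c = ℕtoℚ (suc a) * p (suc a) b c
∂x p a b c = ℕtoℚ (suc b) * p a (suc b) c
∂y p a b c = ℕtoℚ (suc c) * p a b (suc c)

wPoly : Poly
wPoly a b c = if (a ≡ᵇ 1) ∧ (b ≡ᵇ 0) ∧ (c ≡ᵇ 0) then 1ℚ else 0ℚ

-- The derivation D with D(w) = w + wx, D(x) = x + xy, D(y) = y + x^2: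
-- D = D(w) ∂/∂w + D(x) ∂/∂x + D(y) ∂/∂y (the unique derivation with
-- these values on the generators).
D : Poly → Poly
D p = (mulMon 1 0 0 (∂w p) ⊕ mulMon 1 1 0 (∂w p))
    ⊕ ((mulMon 0 1 0 (∂x p) ⊕ mulMon 0 1 1 (∂x p))
    ⊕ (mulMon 0 0 1 (∂y p) ⊕ mulMon 0 2 0 (∂y p)))

Dpow : ℕ → Poly → Poly
Dpow zero p = p
Dpow (suc n) p = D (Dpow n p)

t : ℕ → ℕ → ℕ → ℚ
t n i j = Dpow n wPoly 1 i j

subseqs : List ℕ → List (List ℕ)
subseqs [] = [] ∷ []
subseqs (x ∷ xs) = map (x ∷_) (subseqs xs) ++ subseqs xs

alt : Bool → List ℕ → Bool
alt true  (a ∷ b ∷ r) = (b <ᵇ a) ∧ alt false (b ∷ r)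
alt false (a ∷ b ∷ r) = (a <ᵇ b) ∧ alt true (b ∷ r)
alt _ _ = true

isAlternating : List ℕ → Bool
isAlternating = alt true

maxAltLength : List ℕ → ℕ
maxAltLength l = foldr _⊔_ 0 (map length (filterᵇ isAlternating (subseqs l)))

-- Cyclically ordered partitions of {1,...,m} with k blocks, in canonical
-- form B_0 B_1 ... B_{k-1} (B_0 ∋ 1), are encoded by the block-index map
-- v : Fin m → Fin k (element toℕ x + 1 lies in block B_{v x}); the
-- admissible maps are exactly the surjections sending element 1 to block 0.

allVecs : (m k : ℕ) → List (Vec (Fin k) m)
allVecs zero k = []ᵥ ∷ []
allVecs (suc m) k = concatMap (λ v → map (_∷ᵥ v) (allFin k)) (allVecs m k)

finEq : ∀ {k} → Fin k → Fin k → Bool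
finEq a b = toℕ a ≡ᵇ toℕ b

firstInBlock0 : ∀ {m k} → Vec (Fin k) m → Bool
firstInBlock0 []ᵥ = true
firstInBlock0 (b ∷ᵥ _) = toℕ b ≡ᵇ 0

surjective : ∀ {m k} → Vec (Fin k) m → Bool
surjective {m} {k} v = and (map (λ b → or (map (λ x → finEq (lookup v x) b) (allFin m))) (allFin k))

isCOP : ∀ {m k} → Vec (Fin k) m → Bool
isCOP v = firstInBlock0 v ∧ surjective v

-- least element of a list (0 for the empty list; not used on COPs)
headOr0 : List ℕ → ℕ
headOr0 [] = 0
headOr0 (x ∷ _) = x

opener : ∀ {m k} → Vec (Fin k) m → Fin k → ℕ
opener {m} v b = headOr0 (map (λ x → suc (toℕ x)) (filterᵇ (λ x → finEq (lookup v x) b) (allFin m)))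

openers : ∀ {m k} → Vec (Fin k) m → List ℕ
openers {k = k} v = map (opener v) (allFin k)

countCOP : (m k i : ℕ) → ℕ
countCOP m k i = length (filterᵇ (λ v → isCOP v ∧ (maxAltLength (openers v) ≡ᵇ i)) (allVecs m k))

-- D(w x^i y^j) = (1+i+j) w x^i y^j + w x^(i+1) y^j + i w x^i y^(j+1) + j w x^(i+2) y^(j-1),
-- so the t_{n,i,j} are natural numbers obeying a four-term recursion in n.  On the other
-- side, a cyclically ordered partition of {1,…,m+1} arises from one of {1,…,m} either by
-- adding m+1 to one of its k blocks, which keeps the openers, or by a new singleton block
-- {m+1} placed after one of the blocks, which inserts the new maximum m+1 into the list of
-- openers 1 w₂ ⋯ w_k at any position but the first.  The longest alternating subsequence
-- of such a list is found by a greedy scan, and if it has length L, inserting a new maximum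
-- keeps the length at L positions, raises it by one at one position (if k > 1) and by two
-- at the remaining ones.  This gives the counts the same recursion and initial values.

module Submission where

open import Defs
open import Data.Bool using (Bool; true; false; _∧_; _∨_; not; if_then_else_)
open import Data.Bool.Properties
  using (not-involutive; ∧-conicalˡ; ∧-conicalʳ; ∧-zeroʳ; ∨-identityʳ; ∨-zeroʳ)
open import Data.Bool.ListAction using (and; or)
open import Data.Nat using (ℕ; zero; suc; _+_; _*_; _∸_; _⊓_; _⊔_; _<ᵇ_; _≡ᵇ_; _≤_; _<_; _≥_; z≤n; s≤s)
open import Data.Nat.Properties
  using (≤-refl; ≤-trans; ≤-antisym; <-asym; <-irrefl; ≤⇒≯; ≮⇒≥; <⇒≤; n≤1+n; m≤n⇒m≤1+n;
         ≤-<-trans; <-≤-trans; <ᵇ⇒<; <⇒<ᵇ; ≡ᵇ⇒≡; ≡⇒≡ᵇ; m≤m⊔n; m≤n⊔m; ⊔-lub; suc-injective;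
         +-comm; +-suc; +-identityʳ; *-comm; *-assoc; *-identityʳ; *-zeroʳ; m+n∸m≡n; +-*-semiring)
open import Data.Nat.Solver using (module +-*-Solver)
import Data.Nat.ListAction as List
open import Data.Nat.ListAction.Properties using (sum-++)
import Data.Nat.Coprimality as Coprime
import Data.Integer as ℤ
import Data.Integer.Properties as ℤ
import Data.Rational as ℚ
import Data.Rational.Properties as ℚ
open import Data.Fin using (Fin; toℕ; punchIn) renaming (zero to fzero; suc to fsuc)
open import Data.Fin.Properties
  using (toℕ-injective; punchIn-injective; punchInᵢ≢i) renaming (suc-injective to fsuc-injective)
open import Data.List using (List; []; _∷_; _++_; map; filterᵇ; length; foldr; concatMap; tabulate; allFin)
open import Data.List.Properties using (map-++; map-cong; map-∘; map-tabulate; length-map; length-tabulate)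
open import Data.List.Membership.Propositional using (_∈_)
open import Data.List.Membership.Propositional.Properties using (∈-map⁺; ∈-map⁻; ∈-++⁺ˡ; ∈-++⁺ʳ; ∈-++⁻)
open import Data.List.Relation.Unary.Any using (here; there)
open import Data.List.Relation.Unary.All using (All; []; _∷_)
import Data.List.Relation.Unary.All.Properties as All
open import Data.List.Relation.Unary.AllPairs using ([]; _∷_)
open import Data.List.Relation.Unary.Unique.Propositional using (Unique)
import Data.List.Relation.Unary.Unique.Propositional.Properties as Unique
open import Data.List.Relation.Binary.Sublist.Propositional as Sublist using (_⊆_; []; _∷_)
open import Data.List.Relation.Binary.Sublist.Propositional.Properties using (∷ˡ⁻)
open import Data.Vec using (Vec; lookup; _∷ʳ_) renaming ([] to []ᵥ; _∷_ to _∷ᵥ_; map to mapᵥ)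
open import Data.Product using (∃-syntax; _×_; _,_)
open import Data.Sum using (inj₁; inj₂)
open import Data.Unit using (tt)
open import Data.Empty using (⊥-elim)
open import Function using (_∘_; id)
open import Relation.Binary.PropositionalEquality
open import Algebra.Properties.Semiring.Sum +-*-semiring
  using (sum; sum-syntax; ∑-distrib-+; ∑-comm; *-distribˡ-sum; *-distribʳ-sum; sum-cong-≗)

open +-*-Solver using (solve; _:+_; _:*_; _:=_; con)

-- Natural-number coefficients of D^n(w)

ℕtoℚ≡mkℚ : ∀ n → ℕtoℚ n ≡ ℚ.mkℚ (ℤ.+ n) 0 (Coprime.sym (Coprime.1-coprimeTo n))
ℕtoℚ≡mkℚ n = ℚ.normalize-coprime (Coprime.sym (Coprime.1-coprimeTo n))

ℕtoℚ-homo-+ : ∀ m n → ℕtoℚ (m + n) ≡ ℕtoℚ m ℚ.+ ℕtoℚ n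
ℕtoℚ-homo-+ m n rewrite ℕtoℚ≡mkℚ m | ℕtoℚ≡mkℚ n =
  cong (ℚ._/ 1) (trans (ℤ.pos-+ m n) (sym (cong₂ ℤ._+_ (ℤ.*-identityʳ (ℤ.+ m)) (ℤ.*-identityʳ (ℤ.+ n)))))

ℕtoℚ-homo-* : ∀ m n → ℕtoℚ (m * n) ≡ ℕtoℚ m ℚ.* ℕtoℚ n
ℕtoℚ-homo-* m n rewrite ℕtoℚ≡mkℚ m | ℕtoℚ≡mkℚ n = cong (ℚ._/ 1) (ℤ.pos-* m n)

Polyℕ : Set
Polyℕ = ℕ → ℕ → ℕ → ℕ

_⊕ℕ_ : Polyℕ → Polyℕ → Polyℕ
(p ⊕ℕ q) a b c = p a b c + q a b c

mulMonℕ : ℕ → ℕ → ℕ → Polyℕ → Polyℕ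
mulMonℕ e f g p a b c =
  if (a <ᵇ e) ∨ (b <ᵇ f) ∨ (c <ᵇ g) then 0 else p (a ∸ e) (b ∸ f) (c ∸ g)

∂wℕ ∂xℕ ∂yℕ : Polyℕ → Polyℕ
∂wℕ p a b c = suc a * p (suc a) b c
∂xℕ p a b c = suc b * p a (suc b) c
∂yℕ p a b c = suc c * p a b (suc c)

wℕ : Polyℕ
wℕ a b c = if (a ≡ᵇ 1) ∧ (b ≡ᵇ 0) ∧ (c ≡ᵇ 0) then 1 else 0

Dℕ : Polyℕ → Polyℕ
Dℕ p = (mulMonℕ 1 0 0 (∂wℕ p) ⊕ℕ mulMonℕ 1 1 0 (∂wℕ p))
     ⊕ℕ ((mulMonℕ 0 1 0 (∂xℕ p) ⊕ℕ mulMonℕ 0 1 1 (∂xℕ p))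
     ⊕ℕ (mulMonℕ 0 0 1 (∂yℕ p) ⊕ℕ mulMonℕ 0 2 0 (∂yℕ p)))

-- A record rather than a function type, so that ↦-D can infer the polynomials involved.
record _↦_ (p : Polyℕ) (q : Poly) : Set where
  constructor embeds
  field coefficient : ∀ a b c → ℕtoℚ (p a b c) ≡ q a b c
open _↦_

↦-⊕ : ∀ {p p′ q q′} → p ↦ q → p′ ↦ q′ → (p ⊕ℕ p′) ↦ (q ⊕ q′)
↦-⊕ {p} {p′} r r′ = embeds λ a b c →
  trans (ℕtoℚ-homo-+ (p a b c) (p′ a b c)) (cong₂ ℚ._+_ (coefficient r a b c) (coefficient r′ a b c))

↦-mulMon : ∀ e f g {p q} → p ↦ q → mulMonℕ e f g p ↦ mulMon e f g q
↦-mulMon e f g {p} {q} r = embeds coeff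
  where
  coeff : ∀ a b c → ℕtoℚ (mulMonℕ e f g p a b c) ≡ mulMon e f g q a b c
  coeff a b c with (a <ᵇ e) ∨ (b <ᵇ f) ∨ (c <ᵇ g)
  ... | true  = refl
  ... | false = coefficient r (a ∸ e) (b ∸ f) (c ∸ g)

↦-∂w : ∀ {p q} → p ↦ q → ∂wℕ p ↦ ∂w q
↦-∂w {p} r = embeds λ a b c →
  trans (ℕtoℚ-homo-* (suc a) (p (suc a) b c)) (cong (ℕtoℚ (suc a) ℚ.*_) (coefficient r (suc a) b c))

↦-∂x : ∀ {p q} → p ↦ q → ∂xℕ p ↦ ∂x q
↦-∂x {p} r = embeds λ a b c →
  trans (ℕtoℚ-homo-* (suc b) (p a (suc b) c)) (cong (ℕtoℚ (suc b) ℚ.*_) (coefficient r a (suc b) c))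

↦-∂y : ∀ {p q} → p ↦ q → ∂yℕ p ↦ ∂y q
↦-∂y {p} r = embeds λ a b c →
  trans (ℕtoℚ-homo-* (suc c) (p a b (suc c))) (cong (ℕtoℚ (suc c) ℚ.*_) (coefficient r a b (suc c)))

↦-D : ∀ {p q} → p ↦ q → Dℕ p ↦ D q
↦-D r = ↦-⊕ (↦-⊕ (↦-mulMon 1 0 0 (↦-∂w r)) (↦-mulMon 1 1 0 (↦-∂w r)))
            (↦-⊕ (↦-⊕ (↦-mulMon 0 1 0 (↦-∂x r)) (↦-mulMon 0 1 1 (↦-∂x r)))
                 (↦-⊕ (↦-mulMon 0 0 1 (↦-∂y r)) (↦-mulMon 0 2 0 (↦-∂y r))))

↦-w : wℕ ↦ wPoly
↦-w = embeds coeff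
  where
  coeff : ∀ a b c → ℕtoℚ (wℕ a b c) ≡ wPoly a b c
  coeff a b c with (a ≡ᵇ 1) ∧ (b ≡ᵇ 0) ∧ (c ≡ᵇ 0)
  ... | true  = refl
  ... | false = refl

Dℕ^_ : ℕ → Polyℕ → Polyℕ
(Dℕ^ zero) p = p
(Dℕ^ suc n) p = Dℕ ((Dℕ^ n) p)

↦-Dpow : ∀ n → (Dℕ^ n) wℕ ↦ Dpow n wPoly
↦-Dpow zero    = ↦-w
↦-Dpow (suc n) = ↦-D (↦-Dpow n)

T : ℕ → ℕ → ℕ → ℕ
T n i j = (Dℕ^ n) wℕ 1 i j

t≡T : ∀ n i j → t n i j ≡ ℕtoℚ (T n i j)
t≡T n i j = sym (coefficient (↦-Dpow n) 1 i j)

Dℕ-x⁰ : ∀ p j → Dℕ p 1 0 j ≡ suc j * p 1 0 j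
Dℕ-x⁰ p zero    = solve 1 (λ P → (con 1 :* P :+ con 0) :+ ((con 0 :+ con 0) :+ (con 0 :+ con 0))
                               := con 1 :* P)
                          refl (p 1 0 0)
Dℕ-x⁰ p (suc j) = solve 2 (λ J P → (con 1 :* P :+ con 0) :+ ((con 0 :+ con 0) :+ ((con 1 :+ J) :* P :+ con 0))
                                 := (con 2 :+ J) :* P)
                          refl j (p 1 0 (suc j))

T-x⁰y⁰ : ∀ n → T n 0 0 ≡ 1
T-x⁰y⁰ zero    = refl
T-x⁰y⁰ (suc n) = trans (Dℕ-x⁰ ((Dℕ^ n) wℕ) 0) (cong (1 *_) (T-x⁰y⁰ n))

T-x⁰y⁺ : ∀ n j → T n 0 (suc j) ≡ 0
T-x⁰y⁺ zero    j = refl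
T-x⁰y⁺ (suc n) j =
  trans (Dℕ-x⁰ ((Dℕ^ n) wℕ) (suc j)) (trans (cong (suc (suc j) *_) (T-x⁰y⁺ n j)) (*-zeroʳ (suc (suc j))))

xyPart x²Part : Polyℕ → ℕ → ℕ → ℕ
xyPart p a zero    = 0
xyPart p a (suc j) = suc a * p 1 (suc a) j
x²Part p zero    j = 0
x²Part p (suc a) j = suc j * p 1 a (suc j)

Dℕ-x⁺ : ∀ p a j →
  Dℕ p 1 (suc a) j ≡ (2 + a + j) * p 1 (suc a) j + (p 1 a j + xyPart p a j + x²Part p a j)
Dℕ-x⁺ p zero zero = solve 2
  (λ X Y → (con 1 :* X :+ con 1 :* Y) :+ ((con 1 :* X :+ con 0) :+ (con 0 :+ con 0))
         := con 2 :* X :+ (Y :+ con 0 :+ con 0))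
  refl (p 1 1 0) (p 1 0 0)
Dℕ-x⁺ p zero (suc j) = solve 4
  (λ J X Y Z → (con 1 :* X :+ con 1 :* Y) :+ ((con 1 :* X :+ con 1 :* Z) :+ ((con 1 :+ J) :* X :+ con 0))
             := (con 2 :+ (con 1 :+ J)) :* X :+ (Y :+ con 1 :* Z :+ con 0))
  refl j (p 1 1 (suc j)) (p 1 0 (suc j)) (p 1 1 j)
Dℕ-x⁺ p (suc a) zero = solve 4
  (λ A X Y W → (con 1 :* X :+ con 1 :* Y) :+ (((con 2 :+ A) :* X :+ con 0) :+ (con 0 :+ con 1 :* W))
             := (con 2 :+ (con 1 :+ A) :+ con 0) :* X :+ (Y :+ con 0 :+ con 1 :* W))
  refl a (p 1 (suc (suc a)) 0) (p 1 (suc a) 0) (p 1 a 1)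
Dℕ-x⁺ p (suc a) (suc j) = solve 6
  (λ A J X Y Z W → (con 1 :* X :+ con 1 :* Y)
                   :+ (((con 2 :+ A) :* X :+ (con 2 :+ A) :* Z) :+ ((con 1 :+ J) :* X :+ (con 2 :+ J) :* W))
                 := (con 2 :+ (con 1 :+ A) :+ (con 1 :+ J)) :* X :+ (Y :+ (con 2 :+ A) :* Z :+ (con 2 :+ J) :* W))
  refl a j (p 1 (suc (suc a)) (suc j)) (p 1 (suc a) (suc j)) (p 1 (suc (suc a)) j) (p 1 a (suc (suc j)))

true≢false : true ≢ false
true≢false ()

≡true⇒T : ∀ {b} → b ≡ true → Data.Bool.T b
≡true⇒T refl = tt

<ᵇ-true⇒< : ∀ a b → (a <ᵇ b) ≡ true → a < b
<ᵇ-true⇒< a b e = <ᵇ⇒< a b (≡true⇒T e)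

<ᵇ-false⇒≥ : ∀ a b → (a <ᵇ b) ≡ false → b ≤ a
<ᵇ-false⇒≥ a b e = ≮⇒≥ (λ a<b → subst Data.Bool.T e (<⇒<ᵇ a<b))

<⇒<ᵇ-true : ∀ a b → a < b → (a <ᵇ b) ≡ true
<⇒<ᵇ-true a b a<b with a <ᵇ b in e
... | true  = refl
... | false = ⊥-elim (subst Data.Bool.T e (<⇒<ᵇ a<b))

≥⇒<ᵇ-false : ∀ a b → b ≤ a → (a <ᵇ b) ≡ false
≥⇒<ᵇ-false a b b≤a with a <ᵇ b in e
... | true  = ⊥-elim (≤⇒≯ b≤a (<ᵇ-true⇒< a b e))
... | false = refl

ind : Bool → ℕ
ind true  = 1
ind false = 0

*-ind-≡ᵇ : ∀ (g : ℕ → ℕ) n c → g n * ind (n ≡ᵇ c) ≡ g c * ind (n ≡ᵇ c)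
*-ind-≡ᵇ g n c with n ≡ᵇ c in e
... | true  = cong (λ x → g x * 1) (≡ᵇ⇒≡ n c (≡true⇒T e))
... | false = trans (*-zeroʳ (g n)) (sym (*-zeroʳ (g c)))

ind-≡ᵇ-< : ∀ {n c} → n < c → ind (n ≡ᵇ c) ≡ 0
ind-≡ᵇ-< {n} {c} n<c with n ≡ᵇ c in e
... | true  = ⊥-elim (<-irrefl (≡ᵇ⇒≡ n c (≡true⇒T e)) n<c)
... | false = refl

-- Longest alternating subsequences

ordered : Bool → ℕ → ℕ → Bool
ordered true  a b = b <ᵇ a
ordered false a b = a <ᵇ b

alt-∷-∷ : ∀ d a b r → alt d (a ∷ b ∷ r) ≡ ordered d a b ∧ alt (not d) (b ∷ r)
alt-∷-∷ true  a b r = refl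
alt-∷-∷ false a b r = refl

alt-head : ∀ d a b r → alt d (a ∷ b ∷ r) ≡ true → ordered d a b ≡ true
alt-head d a b r e = ∧-conicalˡ _ _ (trans (sym (alt-∷-∷ d a b r)) e)

alt-tail : ∀ d a b r → alt d (a ∷ b ∷ r) ≡ true → alt (not d) (b ∷ r) ≡ true
alt-tail d a b r e = ∧-conicalʳ (ordered d a b) _ (trans (sym (alt-∷-∷ d a b r)) e)

alt-cons : ∀ d a b r → ordered d a b ≡ true → alt (not d) (b ∷ r) ≡ true → alt d (a ∷ b ∷ r) ≡ true
alt-cons d a b r e e′ = trans (alt-∷-∷ d a b r) (cong₂ _∧_ e e′)

-- In direction d, a current term x can be followed by everything z can.
Dominates : Bool → ℕ → ℕ → Set
Dominates true  x z = z ≤ x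
Dominates false x z = x ≤ z

dominates-refl : ∀ d x → Dominates d x x
dominates-refl true  x = ≤-refl
dominates-refl false x = ≤-refl

dominates-trans : ∀ d {x y z} → Dominates d x y → Dominates d y z → Dominates d x z
dominates-trans true  p q = ≤-trans q p
dominates-trans false p q = ≤-trans p q

unordered⇒dominates : ∀ d x y → ordered d x y ≡ false → Dominates d y x
unordered⇒dominates true  x y e = <ᵇ-false⇒≥ y x e
unordered⇒dominates false x y e = <ᵇ-false⇒≥ x y e

dominates-unordered : ∀ d {x z} y → Dominates d x z → ordered d x y ≡ false → ordered d z y ≡ false
dominates-unordered true  {x} {z} y z≤x e = ≥⇒<ᵇ-false y z (≤-trans z≤x (<ᵇ-false⇒≥ y x e))
dominates-unordered false {x} {z} y x≤z e = ≥⇒<ᵇ-false z y (≤-trans (<ᵇ-false⇒≥ x y e) x≤z)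

ordered-dominates : ∀ d x {y y′} → ordered d x y ≡ true → Dominates (not d) y′ y → ordered d x y′ ≡ true
ordered-dominates true  x {y} {y′} e y′≤y = <⇒<ᵇ-true y′ x (≤-<-trans y′≤y (<ᵇ-true⇒< y x e))
ordered-dominates false x {y} {y′} e y≤y′ = <⇒<ᵇ-true x y′ (<-≤-trans (<ᵇ-true⇒< x y e) y≤y′)

-- A term that is not ordered after the current one dominates it, and so replaces it.
greedy : Bool → ℕ → List ℕ → ℕ
greedy d x []       = 0
greedy d x (y ∷ ys) = if ordered d x y then suc (greedy (not d) y ys) else greedy d y ys

greedy-≤-length : ∀ d x l → greedy d x l ≤ length l
greedy-≤-length d x []       = z≤n
greedy-≤-length d x (y ∷ ys) with ordered d x y
... | true  = s≤s (greedy-≤-length _ y ys)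
... | false = m≤n⇒m≤1+n (greedy-≤-length d y ys)

mutual
  greedy-maximal : ∀ d x {l s} → s ⊆ l → ∀ z → Dominates d x z → alt d (z ∷ s) ≡ true →
                   length s ≤ greedy d x l
  greedy-maximal d x [] z _ _ = z≤n
  greedy-maximal d x (y Sublist.∷ʳ σ) z x≽z al with ordered d x y in o
  ... | true  = greedy-maximal′ (not d) y σ z (subst (λ e → alt e _ ≡ true) (sym (not-involutive d)) al)
  ... | false = greedy-maximal d y σ z (dominates-trans d (unordered⇒dominates d x y o) x≽z) al
  greedy-maximal d x (_∷_ {y = y} refl σ) z x≽z al with ordered d x y in o
  ... | true  = s≤s (greedy-maximal (not d) y σ y (dominates-refl (not d) y) (alt-tail d z y _ al))
  ... | false = ⊥-elim (true≢false (trans (sym (alt-head d z y _ al)) (dominates-unordered d y x≽z o)))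

  greedy-maximal′ : ∀ d x {l s} → s ⊆ l → ∀ z → alt (not d) (z ∷ s) ≡ true →
                    length s ≤ suc (greedy d x l)
  greedy-maximal′ d x {s = []} _ z _ = z≤n
  greedy-maximal′ d x {s = s₁ ∷ s} (y Sublist.∷ʳ σ) z al with ordered d x y in o
  ... | true  = s≤s (greedy-maximal′ (not d) y (∷ˡ⁻ σ) s₁ (alt-tail (not d) z s₁ s al))
  ... | false = greedy-maximal′ d y σ z al
  greedy-maximal′ d x {s = y ∷ s} (refl ∷ σ) z al with ordered d x y in o
  ... | true  = s≤s (greedy-maximal′ (not d) y σ y (alt-tail (not d) z y s al))
  ... | false = s≤s (greedy-maximal d y σ y (dominates-refl d y)
                       (subst (λ e → alt e (y ∷ s) ≡ true) (not-involutive d) (alt-tail (not d) z y s al)))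

greedy-witness : ∀ d x l → ∃[ x′ ] ∃[ s ] (x′ ∷ s) ⊆ (x ∷ l) × Dominates d x′ x × alt d (x′ ∷ s) ≡ true
                 × length s ≡ greedy d x l
greedy-witness true  x [] = x , [] , refl ∷ [] , ≤-refl , refl , refl
greedy-witness false x [] = x , [] , refl ∷ [] , ≤-refl , refl , refl
greedy-witness d x (y ∷ ys) with ordered d x y in o
... | true with greedy-witness (not d) y ys
...   | y′ , s , σ , y′≽y , al , len =
        x , y′ ∷ s , refl ∷ σ , dominates-refl d x , alt-cons d x y′ s (ordered-dominates d x o y′≽y) al , cong suc len
greedy-witness d x (y ∷ ys) | false with greedy-witness d y ys
...   | y′ , s , σ , y′≽y , al , len =
        y′ , s , x Sublist.∷ʳ σ , dominates-trans d y′≽y (unordered⇒dominates d x y o) , al , len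

greedy-flip : ∀ d y l → greedy d y l ≤ suc (greedy (not d) y l)
greedy-flip d y [] = z≤n
greedy-flip true y (w ∷ ws) with w <ᵇ y in e₁ | y <ᵇ w in e₂
... | true  | true  = ⊥-elim (<-asym (<ᵇ-true⇒< w y e₁) (<ᵇ-true⇒< y w e₂))
... | true  | false = ≤-refl
... | false | true  = m≤n⇒m≤1+n (n≤1+n _)
... | false | false = greedy-flip true w ws
greedy-flip false y (w ∷ ws) with y <ᵇ w in e₁ | w <ᵇ y in e₂
... | true  | true  = ⊥-elim (<-asym (<ᵇ-true⇒< y w e₁) (<ᵇ-true⇒< w y e₂))
... | true  | false = ≤-refl
... | false | true  = m≤n⇒m≤1+n (n≤1+n _)
... | false | false = greedy-flip false w ws

alternating-length-≤ : ∀ x l {s} → s ⊆ (x ∷ l) → alt true s ≡ true → length s ≤ suc (greedy true x l)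
alternating-length-≤ x l       (refl ∷ σ)      al = s≤s (greedy-maximal true x σ x ≤-refl al)
alternating-length-≤ x []      (_ Sublist.∷ʳ [])       al = z≤n
alternating-length-≤ x (y ∷ l) (_ Sublist.∷ʳ σ)        al = ≤-trans (alternating-length-≤ y l σ al) (s≤s step)
  where
  step : greedy true y l ≤ greedy true x (y ∷ l)
  step with y <ᵇ x
  ... | true  = greedy-flip true y l
  ... | false = ≤-refl

∈-subseqs⁺ : ∀ {s l} → s ⊆ l → s ∈ subseqs l
∈-subseqs⁺ []                   = here refl
∈-subseqs⁺ {l = y ∷ l} (_ Sublist.∷ʳ σ)  = ∈-++⁺ʳ (map (y ∷_) (subseqs l)) (∈-subseqs⁺ σ)
∈-subseqs⁺ {l = y ∷ l} (refl ∷ σ) = ∈-++⁺ˡ (∈-map⁺ (y ∷_) (∈-subseqs⁺ σ))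

∈-subseqs⁻ : ∀ {s} l → s ∈ subseqs l → s ⊆ l
∈-subseqs⁻ []      (here refl) = []
∈-subseqs⁻ (y ∷ l) s∈ with ∈-++⁻ (map (y ∷_) (subseqs l)) s∈
... | inj₂ s∈′ = y Sublist.∷ʳ ∈-subseqs⁻ l s∈′
... | inj₁ s∈′ with ∈-map⁻ (y ∷_) s∈′
...   | _ , s′∈ , refl = refl ∷ ∈-subseqs⁻ l s′∈

maxLength : (List ℕ → Bool) → List (List ℕ) → ℕ
maxLength P L = foldr _⊔_ 0 (map length (filterᵇ P L))

maxLength-≤ : ∀ P B L → (∀ s → s ∈ L → P s ≡ true → length s ≤ B) → maxLength P L ≤ B
maxLength-≤ P B []      bound = z≤n
maxLength-≤ P B (s ∷ L) bound with P s in e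
... | true  = ⊔-lub (bound s (here refl) e) (maxLength-≤ P B L (λ s′ s′∈ → bound s′ (there s′∈)))
... | false = maxLength-≤ P B L (λ s′ s′∈ → bound s′ (there s′∈))

≤-maxLength : ∀ P {s} L → s ∈ L → P s ≡ true → length s ≤ maxLength P L
≤-maxLength P (s ∷ L)  (here refl) e rewrite e = m≤m⊔n _ _
≤-maxLength P (s′ ∷ L) (there s∈)  e with P s′
... | true  = ≤-trans (≤-maxLength P L s∈ e) (m≤n⊔m _ _)
... | false = ≤-maxLength P L s∈ e

maxAltLength-∷ : ∀ x l → maxAltLength (x ∷ l) ≡ suc (greedy true x l)
maxAltLength-∷ x l = ≤-antisym
  (maxLength-≤ isAlternating _ (subseqs (x ∷ l)) λ s s∈ al → alternating-length-≤ x l (∈-subseqs⁻ (x ∷ l) s∈) al)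
  witness
  where
  witness : suc (greedy true x l) ≤ maxAltLength (x ∷ l)
  witness with greedy-witness true x l
  ... | x′ , s , σ , _ , al , len =
    subst (_≤ maxAltLength (x ∷ l)) (cong suc len) (≤-maxLength isAlternating _ (∈-subseqs⁺ σ) al)

-- Inserting a new maximum

insertAt : ℕ → ℕ → List ℕ → List ℕ
insertAt zero    M xs       = M ∷ xs
insertAt (suc p) M []       = M ∷ []
insertAt (suc p) M (x ∷ xs) = x ∷ insertAt p M xs

-- gain d x r p is the increase of greedy d x r when a new maximum is inserted at position p
-- of r (greedy-insertAt).
gainAfter : ℕ → List ℕ → ℕ
gainAfter y []      = 1
gainAfter y (z ∷ _) = if y <ᵇ z then 2 else 0

gainBefore : Bool → ℕ → ℕ → List ℕ → ℕ
gainBefore true  x y ys = if y <ᵇ x then 0 else gainAfter y ys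
gainBefore false x y ys = if x <ᵇ y then gainAfter y ys else 2

gain : Bool → ℕ → List ℕ → ℕ → ℕ
gain d x []       p       = if d then 0 else 1
gain d x (y ∷ ys) zero    = gainBefore d x y ys
gain d x (y ∷ ys) (suc p) = gain (if ordered d x y then not d else d) y ys p

greedy-flip-gainAfter : ∀ y ys → Unique (y ∷ ys) → suc (greedy false y ys) ≡ greedy true y ys + gainAfter y ys
greedy-flip-gainAfter y []       _ = refl
greedy-flip-gainAfter y (z ∷ zs) ((y≢z ∷ _) ∷ _) with y <ᵇ z in e₁ | z <ᵇ y in e₂
... | true  | true  = ⊥-elim (<-asym (<ᵇ-true⇒< y z e₁) (<ᵇ-true⇒< z y e₂))
... | true  | false = +-comm 2 (greedy true z zs)
... | false | true  = sym (+-identityʳ _)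
... | false | false = ⊥-elim (y≢z (≤-antisym (<ᵇ-false⇒≥ z y e₂) (<ᵇ-false⇒≥ y z e₁)))

greedy-insertAt-head : ∀ d x y ys M → x < M → y < M → Unique (y ∷ ys) →
  greedy d x (M ∷ y ∷ ys) ≡ greedy d x (y ∷ ys) + gain d x (y ∷ ys) 0
greedy-insertAt-head true x y ys M x<M y<M u
  rewrite ≥⇒<ᵇ-false M x (<⇒≤ x<M) | <⇒<ᵇ-true y M y<M with y <ᵇ x
... | true  = sym (+-identityʳ _)
... | false = greedy-flip-gainAfter y ys u
greedy-insertAt-head false x y ys M x<M y<M u
  rewrite <⇒<ᵇ-true x M x<M | <⇒<ᵇ-true y M y<M with x <ᵇ y
... | true  = cong suc (greedy-flip-gainAfter y ys u)
... | false = +-comm 2 (greedy false y ys)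

greedy-insertAt : ∀ d x r M → x < M → All (_< M) r → Unique r →
  ∀ p → greedy d x (insertAt p M r) ≡ greedy d x r + gain d x r p
greedy-insertAt true  x [] M x<M _ _ zero    rewrite ≥⇒<ᵇ-false M x (<⇒≤ x<M) = refl
greedy-insertAt true  x [] M x<M _ _ (suc p) rewrite ≥⇒<ᵇ-false M x (<⇒≤ x<M) = refl
greedy-insertAt false x [] M x<M _ _ zero    rewrite <⇒<ᵇ-true x M x<M = refl
greedy-insertAt false x [] M x<M _ _ (suc p) rewrite <⇒<ᵇ-true x M x<M = refl
greedy-insertAt d x (y ∷ ys) M x<M (y<M ∷ _) u zero = greedy-insertAt-head d x y ys M x<M y<M u
greedy-insertAt d x (y ∷ ys) M x<M (y<M ∷ ys<M) (_ ∷ u) (suc p) with ordered d x y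
... | true  = cong suc (greedy-insertAt (not d) y ys M y<M ys<M u p)
... | false = greedy-insertAt d y ys M y<M ys<M u p

gainCount : Bool → ℕ → List ℕ → ℕ → ℕ
gainCount d x r v = ∑[ p < suc (length r) ] ind (gain d x r (toℕ p) ≡ᵇ v)

headBelow : ℕ → List ℕ → ℕ
headBelow x []      = 0
headBelow x (z ∷ _) = ind (z <ᵇ x)

gainAfter≡0 : ∀ y ys → Unique (y ∷ ys) → ind (gainAfter y ys ≡ᵇ 0) ≡ headBelow y ys
gainAfter≡0 y []       _ = refl
gainAfter≡0 y (z ∷ zs) ((y≢z ∷ _) ∷ _) with y <ᵇ z in e₁ | z <ᵇ y in e₂
... | true  | true  = ⊥-elim (<-asym (<ᵇ-true⇒< y z e₁) (<ᵇ-true⇒< z y e₂))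
... | true  | false = refl
... | false | true  = refl
... | false | false = ⊥-elim (y≢z (≤-antisym (<ᵇ-false⇒≥ z y e₂) (<ᵇ-false⇒≥ y z e₁)))

mutual
  gainCount-0-true : ∀ x r → Unique r → gainCount true x r 0 + headBelow x r ≡ suc (greedy true x r)
  gainCount-0-true x []       _ = refl
  gainCount-0-true x (y ∷ ys) u@(_ ∷ u′) with y <ᵇ x
  ... | true  = trans (cong (λ n → suc n + 1) (gainCount-0-false y ys u′)) (+-comm _ 1)
  ... | false = begin
    ind (gainAfter y ys ≡ᵇ 0) + gainCount true y ys 0 + 0  ≡⟨ +-identityʳ _ ⟩
    ind (gainAfter y ys ≡ᵇ 0) + gainCount true y ys 0
      ≡⟨ cong (_+ gainCount true y ys 0) (gainAfter≡0 y ys u) ⟩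
    headBelow y ys + gainCount true y ys 0                  ≡⟨ +-comm (headBelow y ys) _ ⟩
    gainCount true y ys 0 + headBelow y ys                  ≡⟨ gainCount-0-true y ys u′ ⟩
    suc (greedy true y ys)                                   ∎
    where open ≡-Reasoning

  gainCount-0-false : ∀ x r → Unique r → gainCount false x r 0 ≡ greedy false x r
  gainCount-0-false x []       _ = refl
  gainCount-0-false x (y ∷ ys) u@(_ ∷ u′) with x <ᵇ y
  ... | true  = trans (cong (_+ gainCount true y ys 0) (gainAfter≡0 y ys u))
                      (trans (+-comm (headBelow y ys) _) (gainCount-0-true y ys u′))
  ... | false = gainCount-0-false y ys u′

gainBefore-≢1 : ∀ d x y z zs → ind (gainBefore d x y (z ∷ zs) ≡ᵇ 1) ≡ 0
gainBefore-≢1 true  x y z zs with y <ᵇ x | y <ᵇ z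
... | true  | _     = refl
... | false | true  = refl
... | false | false = refl
gainBefore-≢1 false x y z zs with x <ᵇ y | y <ᵇ z
... | true  | true  = refl
... | true  | false = refl
... | false | _     = refl

gainCount-1 : ∀ d x y ys → gainCount d x (y ∷ ys) 1 ≡ 1
gainCount-1 true  x y [] with y <ᵇ x
... | true  = refl
... | false = refl
gainCount-1 false x y [] with x <ᵇ y
... | true  = refl
... | false = refl
gainCount-1 d x y (z ∷ zs) =
  cong₂ _+_ (gainBefore-≢1 d x y z zs) (gainCount-1 (if ordered d x y then not d else d) y z zs)

gain≤2 : ∀ d x r p → gain d x r p ≤ 2
gain≤2 true  x []       p       = z≤n
gain≤2 false x []       p       = s≤s z≤n
gain≤2 true  x (y ∷ ys) zero with y <ᵇ x | ys
... | true  | _      = z≤n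
... | false | []     = s≤s z≤n
... | false | z ∷ _  with y <ᵇ z
...   | true  = ≤-refl
...   | false = z≤n
gain≤2 false x (y ∷ ys) zero with x <ᵇ y | ys
... | false | _      = ≤-refl
... | true  | []     = s≤s z≤n
... | true  | z ∷ _  with y <ᵇ z
...   | true  = ≤-refl
...   | false = z≤n
gain≤2 d x (y ∷ ys) (suc p) = gain≤2 _ y ys p

∑-by-value : ∀ n (g : Fin n → ℕ) → (∀ p → g p ≤ 2) → ∀ (f : ℕ → ℕ) →
  ∑[ p < n ] f (g p) ≡ (∑[ p < n ] ind (g p ≡ᵇ 0)) * f 0 + (∑[ p < n ] ind (g p ≡ᵇ 1)) * f 1
                        + (∑[ p < n ] ind (g p ≡ᵇ 2)) * f 2
∑-by-value n g g≤2 f = begin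
  ∑[ p < n ] f (g p)                                    ≡⟨ sum-cong-≗ (λ p → by-value (g p) (g≤2 p)) ⟩
  ∑[ p < n ] (I 0 p * f 0 + I 1 p * f 1 + I 2 p * f 2)
    ≡⟨ ∑-distrib-+ (λ p → I 0 p * f 0 + I 1 p * f 1) _ ⟩
  ∑[ p < n ] (I 0 p * f 0 + I 1 p * f 1) + ∑[ p < n ] (I 2 p * f 2)
    ≡⟨ cong (_+ ∑[ p < n ] (I 2 p * f 2)) (∑-distrib-+ (λ p → I 0 p * f 0) _) ⟩
  ∑[ p < n ] (I 0 p * f 0) + ∑[ p < n ] (I 1 p * f 1) + ∑[ p < n ] (I 2 p * f 2)
    ≡⟨ sym (cong₂ _+_ (cong₂ _+_ (*-distribʳ-sum (f 0) (I 0)) (*-distribʳ-sum (f 1) (I 1))) (*-distribʳ-sum (f 2) (I 2))) ⟩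
  sum (I 0) * f 0 + sum (I 1) * f 1 + sum (I 2) * f 2  ∎
  where
  open ≡-Reasoning
  I : ℕ → Fin n → ℕ
  I v p = ind (g p ≡ᵇ v)
  by-value : ∀ v → v ≤ 2 → f v ≡ ind (v ≡ᵇ 0) * f 0 + ind (v ≡ᵇ 1) * f 1 + ind (v ≡ᵇ 2) * f 2
  by-value 0 _ = solve 3 (λ a b c → a := con 1 :* a :+ con 0 :* b :+ con 0 :* c) refl (f 0) (f 1) (f 2)
  by-value 1 _ = solve 3 (λ a b c → b := con 0 :* a :+ con 1 :* b :+ con 0 :* c) refl (f 0) (f 1) (f 2)
  by-value 2 _ = solve 3 (λ a b c → c := con 0 :* a :+ con 0 :* b :+ con 1 :* c) refl (f 0) (f 1) (f 2)
  by-value (suc (suc (suc _))) (s≤s (s≤s ()))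

∑-const : ∀ n c → ∑[ i < n ] c ≡ n * c
∑-const zero    c = refl
∑-const (suc n) c = cong (c +_) (∑-const n c)

gainCount-total : ∀ d x r → gainCount d x r 0 + gainCount d x r 1 + gainCount d x r 2 ≡ suc (length r)
gainCount-total d x r = begin
  c 0 + c 1 + c 2
    ≡⟨ sym (cong₂ _+_ (cong₂ _+_ (*-identityʳ (c 0)) (*-identityʳ (c 1))) (*-identityʳ (c 2))) ⟩
  c 0 * 1 + c 1 * 1 + c 2 * 1
    ≡⟨ sym (∑-by-value (suc (length r)) (λ p → gain d x r (toℕ p)) (λ p → gain≤2 d x r (toℕ p)) (λ _ → 1)) ⟩
  ∑[ p < suc (length r) ] 1                      ≡⟨ ∑-const (suc (length r)) 1 ⟩
  suc (length r) * 1                             ≡⟨ *-identityʳ (suc (length r)) ⟩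
  suc (length r)                                 ∎
  where
  open ≡-Reasoning
  c = gainCount d x r

headBelow-1 : ∀ r → All (1 ≤_) r → headBelow 1 r ≡ 0
headBelow-1 []      _         = refl
headBelow-1 (z ∷ _) (1≤z ∷ _) = cong ind (≥⇒<ᵇ-false z 1 1≤z)

gainCount-0 : ∀ r → Unique r → All (1 ≤_) r → gainCount true 1 r 0 ≡ suc (greedy true 1 r)
gainCount-0 r u r≥1 = begin
  gainCount true 1 r 0                    ≡⟨ sym (+-identityʳ _) ⟩
  gainCount true 1 r 0 + 0                ≡⟨ cong (gainCount true 1 r 0 +_) (sym (headBelow-1 r r≥1)) ⟩
  gainCount true 1 r 0 + headBelow 1 r    ≡⟨ gainCount-0-true 1 r u ⟩
  suc (greedy true 1 r)                   ∎
  where open ≡-Reasoning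

gainCount-2 : ∀ r → Unique r → All (1 ≤_) r → gainCount true 1 r 2 ≡ length r ∸ suc (greedy true 1 r)
gainCount-2 []       _ _   = refl
gainCount-2 (y ∷ ys) u r≥1 = sym (begin
  length ys ∸ g                ≡⟨ cong (_∸ g) (sym (suc-injective (suc-injective total))) ⟩
  g + gainCount true 1 r 2 ∸ g ≡⟨ m+n∸m≡n g _ ⟩
  gainCount true 1 r 2         ∎)
  where
  open ≡-Reasoning
  r = y ∷ ys
  g = greedy true 1 r
  total : suc (suc (g + gainCount true 1 r 2)) ≡ suc (suc (length ys))
  total = begin
    suc (suc (g + gainCount true 1 r 2))
      ≡⟨ solve 2 (λ g c → con 2 :+ (g :+ c) := con 1 :+ g :+ con 1 :+ c) refl g _ ⟩
    suc g + 1 + gainCount true 1 r 2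
      ≡⟨ cong₂ (λ a b → a + b + gainCount true 1 r 2) (sym (gainCount-0 r u r≥1)) (sym (gainCount-1 true 1 y ys)) ⟩
    gainCount true 1 r 0 + gainCount true 1 r 1 + gainCount true 1 r 2 ≡⟨ gainCount-total true 1 r ⟩
    suc (suc (length ys))                                            ∎

maxAltLength-insertMax : ∀ r M → 1 < M → All (_< M) r → All (1 ≤_) r → Unique r → ∀ (f : ℕ → ℕ) →
  let L = maxAltLength (1 ∷ r) in
  ∑[ p < suc (length r) ] f (maxAltLength (1 ∷ insertAt (toℕ p) M r))
  ≡ L * f L + (1 ⊓ length r) * f (suc L) + (length r ∸ L) * f (2 + L)
maxAltLength-insertMax r M 1<M r<M r≥1 u f rewrite maxAltLength-∷ 1 r = begin
  ∑[ p < suc (length r) ] f (maxAltLength (1 ∷ insertAt (toℕ p) M r))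
    ≡⟨ sum-cong-≗ {suc (length r)} (λ p → cong f (trans (maxAltLength-∷ 1 (insertAt (toℕ p) M r))
                                                       (cong suc (greedy-insertAt true 1 r M 1<M r<M u (toℕ p))))) ⟩
  ∑[ p < suc (length r) ] F (gain true 1 r (toℕ p))
    ≡⟨ ∑-by-value (suc (length r)) (λ p → gain true 1 r (toℕ p)) (λ p → gain≤2 true 1 r (toℕ p)) F ⟩
  c 0 * F 0 + c 1 * F 1 + c 2 * F 2
    ≡⟨ cong₂ _+_ (cong₂ _+_ (cong₂ _*_ (gainCount-0 r u r≥1) (cong (λ n → f (suc n)) (+-identityʳ g)))
                            (cong₂ _*_ (count-1 r) (cong (λ n → f (suc n)) (+-comm g 1))))
                 (cong₂ _*_ (gainCount-2 r u r≥1) (cong (λ n → f (suc n)) (+-comm g 2))) ⟩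
  suc g * f (suc g) + (1 ⊓ length r) * f (2 + g) + (length r ∸ suc g) * f (3 + g) ∎
  where
  open ≡-Reasoning
  g = greedy true 1 r
  c = gainCount true 1 r
  F : ℕ → ℕ
  F v = f (suc (g + v))
  count-1 : ∀ r → gainCount true 1 r 1 ≡ 1 ⊓ length r
  count-1 []       = refl
  count-1 (y ∷ ys) = gainCount-1 true 1 y ys

∑Vec : ∀ m k → (Vec (Fin k) m → ℕ) → ℕ
∑Vec zero    k f = f []ᵥ
∑Vec (suc m) k f = ∑Vec m k (λ v → ∑[ b < k ] f (b ∷ᵥ v))

length-filterᵇ : ∀ {A : Set} (P : A → Bool) xs → length (filterᵇ P xs) ≡ List.sum (map (ind ∘ P) xs)
length-filterᵇ P []       = refl
length-filterᵇ P (x ∷ xs) with P x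
... | true  = cong suc (length-filterᵇ P xs)
... | false = length-filterᵇ P xs

sum-map-concatMap : ∀ {A B : Set} (f : B → ℕ) (g : A → List B) xs →
  List.sum (map f (concatMap g xs)) ≡ List.sum (map (λ x → List.sum (map f (g x))) xs)
sum-map-concatMap f g []       = refl
sum-map-concatMap f g (x ∷ xs) = begin
  List.sum (map f (g x ++ concatMap g xs))               ≡⟨ cong List.sum (map-++ f (g x) _) ⟩
  List.sum (map f (g x) ++ map f (concatMap g xs))       ≡⟨ sum-++ (map f (g x)) _ ⟩
  List.sum (map f (g x)) + List.sum (map f (concatMap g xs))  ≡⟨ cong (_ +_) (sum-map-concatMap f g xs) ⟩
  List.sum (map f (g x)) + List.sum (map (λ x → List.sum (map f (g x))) xs) ∎
  where open ≡-Reasoning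

sum-tabulate : ∀ n (h : Fin n → ℕ) → List.sum (tabulate h) ≡ ∑[ i < n ] h i
sum-tabulate zero    h = refl
sum-tabulate (suc n) h = cong (h fzero +_) (sum-tabulate n (h ∘ fsuc))

sum-map-allVecs : ∀ m k (f : Vec (Fin k) m → ℕ) → List.sum (map f (allVecs m k)) ≡ ∑Vec m k f
sum-map-allVecs zero    k f = +-identityʳ (f []ᵥ)
sum-map-allVecs (suc m) k f = begin
  List.sum (map f (concatMap (λ v → map (_∷ᵥ v) (allFin k)) (allVecs m k)))
    ≡⟨ sum-map-concatMap f _ (allVecs m k) ⟩
  List.sum (map (λ v → List.sum (map f (map (_∷ᵥ v) (allFin k)))) (allVecs m k))
    ≡⟨ cong List.sum (map-cong row (allVecs m k)) ⟩
  List.sum (map (λ v → ∑[ b < k ] f (b ∷ᵥ v)) (allVecs m k))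
    ≡⟨ sum-map-allVecs m k _ ⟩
  ∑Vec (suc m) k f ∎
  where
  open ≡-Reasoning
  row : ∀ v → List.sum (map f (map (_∷ᵥ v) (allFin k))) ≡ ∑[ b < k ] f (b ∷ᵥ v)
  row v = trans (cong List.sum (trans (sym (map-∘ (allFin k))) (map-tabulate id (f ∘ (_∷ᵥ v)))))
                (sum-tabulate k (f ∘ (_∷ᵥ v)))

∑Vec-cong : ∀ m k {f g : Vec (Fin k) m → ℕ} → (∀ v → f v ≡ g v) → ∑Vec m k f ≡ ∑Vec m k g
∑Vec-cong zero    k f≗g = f≗g []ᵥ
∑Vec-cong (suc m) k f≗g = ∑Vec-cong m k (λ v → sum-cong-≗ (λ b → f≗g (b ∷ᵥ v)))

∑Vec-+ : ∀ m k (f g : Vec (Fin k) m → ℕ) → ∑Vec m k (λ v → f v + g v) ≡ ∑Vec m k f + ∑Vec m k g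
∑Vec-+ zero    k f g = refl
∑Vec-+ (suc m) k f g =
  trans (∑Vec-cong m k (λ v → ∑-distrib-+ (λ b → f (b ∷ᵥ v)) (λ b → g (b ∷ᵥ v)))) (∑Vec-+ m k _ _)

∑Vec-*ˡ : ∀ m k c (f : Vec (Fin k) m → ℕ) → ∑Vec m k (λ v → c * f v) ≡ c * ∑Vec m k f
∑Vec-*ˡ zero    k c f = refl
∑Vec-*ˡ (suc m) k c f =
  trans (∑Vec-cong m k (λ v → sym (*-distribˡ-sum c (λ b → f (b ∷ᵥ v))))) (∑Vec-*ˡ m k c _)

∑Vec-zero : ∀ m k → ∑Vec m k (λ _ → 0) ≡ 0
∑Vec-zero m k = trans (∑Vec-cong m k (λ _ → sym (*-zeroʳ 0))) (∑Vec-*ˡ m k 0 (λ _ → 0))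

∑Vec-comm : ∀ m k n (f : Vec (Fin k) m → Fin n → ℕ) →
  ∑Vec m k (λ v → ∑[ i < n ] f v i) ≡ ∑[ i < n ] ∑Vec m k (λ v → f v i)
∑Vec-comm zero    k n f = refl
∑Vec-comm (suc m) k n f =
  trans (∑Vec-cong m k (λ v → ∑-comm (λ b i → f (b ∷ᵥ v) i))) (∑Vec-comm m k n _)

∑Vec-∷ʳ : ∀ m k (f : Vec (Fin k) (suc m) → ℕ) → ∑Vec (suc m) k f ≡ ∑Vec m k (λ v → ∑[ b < k ] f (v ∷ʳ b))
∑Vec-∷ʳ zero    k f = refl
∑Vec-∷ʳ (suc m) k f = begin
  ∑Vec (suc m) k (λ u → ∑[ c < k ] f (c ∷ᵥ u))
    ≡⟨ ∑Vec-∷ʳ m k (λ u → ∑[ c < k ] f (c ∷ᵥ u)) ⟩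
  ∑Vec m k (λ v → ∑[ b < k ] ∑[ c < k ] f (c ∷ᵥ (v ∷ʳ b)))
    ≡⟨ ∑Vec-cong m k (λ v → ∑-comm (λ b c → f (c ∷ᵥ (v ∷ʳ b)))) ⟩
  ∑Vec m k (λ v → ∑[ c < k ] ∑[ b < k ] f ((c ∷ᵥ v) ∷ʳ b))       ∎
  where open ≡-Reasoning

-- Block-index vectors of cyclically ordered partitions

finEq-true : ∀ {k} {a b : Fin k} → finEq a b ≡ true → a ≡ b
finEq-true {a = a} {b} e = toℕ-injective (≡ᵇ⇒≡ (toℕ a) (toℕ b) (≡true⇒T e))

finEq-refl : ∀ {k} (a : Fin k) → finEq a a ≡ true
finEq-refl a with finEq a a in e
... | true  = refl
... | false = ⊥-elim (subst Data.Bool.T e (≡⇒≡ᵇ (toℕ a) (toℕ a) refl))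

finEq-false : ∀ {k} {a b : Fin k} → a ≢ b → finEq a b ≡ false
finEq-false {a = a} {b} a≢b with finEq a b in e
... | true  = ⊥-elim (a≢b (finEq-true e))
... | false = refl

finEq-injective : ∀ {k l} (f : Fin k → Fin l) → (∀ {a b} → f a ≡ f b → a ≡ b) →
                  ∀ a b → finEq (f a) (f b) ≡ finEq a b
finEq-injective f f-inj a b with finEq a b in e
... | true  = subst (λ c → finEq (f c) (f b) ≡ true) (sym (finEq-true e)) (finEq-refl (f b))
... | false = finEq-false λ fa≡fb →
  true≢false (trans (sym (finEq-refl b)) (trans (cong (λ c → finEq c b) (sym (f-inj fa≡fb))) e))

map-allFin-suc : ∀ {A : Set} m (h : Fin (suc m) → A) → map h (allFin (suc m)) ≡ h fzero ∷ map (h ∘ fsuc) (allFin m)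
map-allFin-suc m h = cong (h fzero ∷_) (trans (map-tabulate fsuc h) (sym (map-tabulate id (h ∘ fsuc))))

occurs : ∀ {k m} → Fin k → Vec (Fin k) m → Bool
occurs c []ᵥ      = false
occurs c (x ∷ᵥ v) = finEq x c ∨ occurs c v

every : ∀ n → (Fin n → Bool) → Bool
every zero    g = true
every (suc n) g = g fzero ∧ every n (g ∘ fsuc)

or-occurs : ∀ {k} m (v : Vec (Fin k) m) c → or (map (λ x → finEq (lookup v x) c) (allFin m)) ≡ occurs c v
or-occurs zero    []ᵥ      c = refl
or-occurs (suc m) (x ∷ᵥ v) c =
  trans (cong or (map-allFin-suc m (λ y → finEq (lookup (x ∷ᵥ v) y) c))) (cong (finEq x c ∨_) (or-occurs m v c))

and-every : ∀ n (g : Fin n → Bool) → and (map g (allFin n)) ≡ every n g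
and-every zero    g = refl
and-every (suc n) g = trans (cong and (map-allFin-suc n g)) (cong (g fzero ∧_) (and-every n (g ∘ fsuc)))

surjective≡every : ∀ {k m} (v : Vec (Fin k) m) → surjective v ≡ every k (λ c → occurs c v)
surjective≡every {k} {m} v = trans (cong and (map-cong (or-occurs m v) (allFin k))) (and-every k _)

every-cong : ∀ n {g h : Fin n → Bool} → (∀ i → g i ≡ h i) → every n g ≡ every n h
every-cong zero    g≗h = refl
every-cong (suc n) g≗h = cong₂ _∧_ (g≗h fzero) (every-cong n (g≗h ∘ fsuc))

every-true : ∀ n (g : Fin n → Bool) → every n g ≡ true → ∀ i → g i ≡ true
every-true (suc n) g e i with g fzero in e₀
every-true (suc n) g e fzero    | true = e₀
every-true (suc n) g e (fsuc i) | true = every-true n (g ∘ fsuc) e i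

every-false : ∀ n (g : Fin n → Bool) i → g i ≡ false → every n g ≡ false
every-false (suc n) g fzero    e rewrite e = refl
every-false (suc n) g (fsuc i) e with g fzero
... | true  = every-false n (g ∘ fsuc) i e
... | false = refl

every-punchIn : ∀ K (b : Fin (suc K)) (h : Fin (suc K) → Bool) → every (suc K) h ≡ h b ∧ every K (h ∘ punchIn b)
every-punchIn K       fzero    h = refl
every-punchIn (suc K) (fsuc b) h = trans (cong (h fzero ∧_) (every-punchIn K b (h ∘ fsuc))) (swap (h fzero) (h (fsuc b)) _)
  where swap : ∀ a b c → a ∧ (b ∧ c) ≡ b ∧ (a ∧ c)
        swap true  b c = refl
        swap false true  c = refl
        swap false false c = refl

-- firstPos c v is 1 + the index of the first occurrence of c in v, and 0 (as for opener)
-- if c does not occur; bump shifts genuine positions and keeps that 0.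
bump : ℕ → ℕ
bump zero    = zero
bump (suc n) = suc (suc n)

bump-≤ : ∀ {n m} → n ≤ m → bump n ≤ suc m
bump-≤ z≤n       = z≤n
bump-≤ (s≤s n≤m) = s≤s (s≤s n≤m)

bump≢1 : ∀ n → bump n ≢ 1
bump≢1 zero    ()
bump≢1 (suc n) ()

bump-injective : ∀ n n′ → bump n ≡ bump n′ → n ≡ n′
bump-injective zero    zero     e    = refl
bump-injective (suc n) (suc n′) refl = refl

firstPos : ∀ {k m} → Fin k → Vec (Fin k) m → ℕ
firstPos c []ᵥ      = 0
firstPos c (x ∷ᵥ v) = if finEq x c then 1 else bump (firstPos c v)

firstPos-≤ : ∀ {k m} (c : Fin k) (v : Vec (Fin k) m) → firstPos c v ≤ m
firstPos-≤ c []ᵥ      = z≤n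
firstPos-≤ c (x ∷ᵥ v) with finEq x c
... | true  = s≤s z≤n
... | false = bump-≤ (firstPos-≤ c v)

firstPos-pos : ∀ {k m} (c : Fin k) (v : Vec (Fin k) m) → occurs c v ≡ true → 1 ≤ firstPos c v
firstPos-pos c (x ∷ᵥ v) c∈v with finEq x c
... | true  = s≤s z≤n
... | false with firstPos c v | firstPos-pos c v c∈v
...   | suc _ | _ = s≤s z≤n

firstPos-injective : ∀ {k m} (c c′ : Fin k) (v : Vec (Fin k) m) → occurs c v ≡ true →
                     firstPos c v ≡ firstPos c′ v → c ≡ c′
firstPos-injective c c′ (x ∷ᵥ v) c∈v e with finEq x c in e₁ | finEq x c′ in e₂
... | true  | true  = trans (sym (finEq-true {a = x} e₁)) (finEq-true {a = x} e₂)
... | true  | false = ⊥-elim (bump≢1 _ (sym e))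
... | false | true  = ⊥-elim (bump≢1 _ e)
... | false | false = firstPos-injective c c′ v c∈v (bump-injective _ _ e)

headOr0-filter-suc : ∀ {m} (P : Fin (suc m) → Bool) (xs : List (Fin m)) →
  headOr0 (map (suc ∘ toℕ) (filterᵇ P (map fsuc xs))) ≡ bump (headOr0 (map (suc ∘ toℕ) (filterᵇ (P ∘ fsuc) xs)))
headOr0-filter-suc P []       = refl
headOr0-filter-suc P (x ∷ xs) with P (fsuc x)
... | true  = refl
... | false = headOr0-filter-suc P xs

opener≡firstPos : ∀ {k} m (v : Vec (Fin k) m) c → opener v c ≡ firstPos c v
opener≡firstPos zero    []ᵥ      c = refl
opener≡firstPos (suc m) (x ∷ᵥ v) c with finEq x c
... | true  = refl
... | false = begin
  headOr0 (map (suc ∘ toℕ) (filterᵇ P (tabulate fsuc)))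
    ≡⟨ cong (λ l → headOr0 (map (suc ∘ toℕ) (filterᵇ P l))) (sym (map-tabulate id fsuc)) ⟩
  headOr0 (map (suc ∘ toℕ) (filterᵇ P (map fsuc (allFin m))))   ≡⟨ headOr0-filter-suc P (allFin m) ⟩
  bump (opener v c)                                              ≡⟨ cong bump (opener≡firstPos m v c) ⟩
  bump (firstPos c v)                                            ∎
  where
  open ≡-Reasoning
  P = λ y → finEq (lookup (x ∷ᵥ v) y) c

openers≡ : ∀ {k m} (v : Vec (Fin k) m) → openers v ≡ map (λ c → firstPos c v) (allFin k)
openers≡ {k} {m} v = map-cong (opener≡firstPos m v) (allFin k)

isCOP-∷ : ∀ {k m} (x : Fin k) (v : Vec (Fin k) m) →
          isCOP (x ∷ᵥ v) ≡ (toℕ x ≡ᵇ 0) ∧ every k (λ c → occurs c (x ∷ᵥ v))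
isCOP-∷ x v = cong ((toℕ x ≡ᵇ 0) ∧_) (surjective≡every (x ∷ᵥ v))

isCOP⇒occurs : ∀ {k m} (v : Vec (Fin k) (suc m)) → isCOP v ≡ true → ∀ c → occurs c v ≡ true
isCOP⇒occurs {k} (x ∷ᵥ v) e = every-true k _ (∧-conicalʳ _ _ (trans (sym (isCOP-∷ x v)) e))

laterOpeners : ∀ {K m} → Vec (Fin (suc K)) m → List ℕ
laterOpeners {K} w = map (λ d → firstPos (fsuc d) w) (allFin K)

openers-COP : ∀ {K m} (w : Vec (Fin (suc K)) (suc m)) → isCOP w ≡ true → openers w ≡ 1 ∷ laterOpeners w
openers-COP {K} (fzero ∷ᵥ v) _ = trans (openers≡ (fzero ∷ᵥ v)) (map-allFin-suc K (λ c → firstPos c (fzero ∷ᵥ v)))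
openers-COP (fsuc x ∷ᵥ v) ()

length-laterOpeners : ∀ {K m} (w : Vec (Fin (suc K)) m) → length (laterOpeners w) ≡ K
length-laterOpeners {K} w = trans (length-map _ (allFin K)) (length-tabulate (λ i → i))

laterOpeners-< : ∀ {K m} (w : Vec (Fin (suc K)) m) → All (_< suc m) (laterOpeners w)
laterOpeners-< {K} w = All.map⁺ (All.tabulate⁺ (λ d → s≤s (firstPos-≤ (fsuc d) w)))

laterOpeners-pos : ∀ {K m} (w : Vec (Fin (suc K)) (suc m)) → isCOP w ≡ true → All (1 ≤_) (laterOpeners w)
laterOpeners-pos w cop = All.map⁺ (All.tabulate⁺ (λ d → firstPos-pos (fsuc d) w (isCOP⇒occurs w cop (fsuc d))))

laterOpeners-unique : ∀ {K m} (w : Vec (Fin (suc K)) (suc m)) → isCOP w ≡ true → Unique (laterOpeners w)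
laterOpeners-unique {K} w cop =
  Unique.map⁺ (λ {d} e → fsuc-injective (firstPos-injective _ _ w (isCOP⇒occurs w cop (fsuc d)) e)) (Unique.allFin⁺ K)

occurs-∷ʳ : ∀ {k m} (c : Fin k) (v : Vec (Fin k) m) b → occurs c (v ∷ʳ b) ≡ occurs c v ∨ finEq b c
occurs-∷ʳ c []ᵥ      b = ∨-identityʳ (finEq b c)
occurs-∷ʳ c (x ∷ᵥ v) b rewrite occurs-∷ʳ c v b with finEq x c
... | true  = refl
... | false = refl

firstPos-∷ʳ : ∀ {k m} (c : Fin k) (v : Vec (Fin k) m) b → occurs c v ≡ true → firstPos c (v ∷ʳ b) ≡ firstPos c v
firstPos-∷ʳ c (x ∷ᵥ v) b c∈v with finEq x c
... | true  = refl
... | false = cong bump (firstPos-∷ʳ c v b c∈v)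

firstPos-∷ʳ-new : ∀ {k m} (v : Vec (Fin k) m) b → occurs b v ≡ false → firstPos b (v ∷ʳ b) ≡ suc m
firstPos-∷ʳ-new []ᵥ      b _ rewrite finEq-refl b = refl
firstPos-∷ʳ-new (x ∷ᵥ v) b b∉v with finEq x b
firstPos-∷ʳ-new (x ∷ᵥ v) b () | true
... | false = cong bump (firstPos-∷ʳ-new v b b∉v)

occurs-∷ʳ-old : ∀ {k m} (v : Vec (Fin k) m) {b} → occurs b v ≡ true → ∀ c → occurs c (v ∷ʳ b) ≡ occurs c v
occurs-∷ʳ-old v {b} b∈v c with finEq b c in e
... | true  with refl ← finEq-true {a = b} {c} e =
  trans (occurs-∷ʳ c v c) (trans (cong (occurs c v ∨_) (finEq-refl c)) (trans (∨-zeroʳ _) (sym b∈v)))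
... | false = trans (occurs-∷ʳ c v b) (trans (cong (occurs c v ∨_) e) (∨-identityʳ _))

isCOP-∷ʳ-old : ∀ {k m} (v : Vec (Fin k) (suc m)) {b} → occurs b v ≡ true → isCOP (v ∷ʳ b) ≡ isCOP v
isCOP-∷ʳ-old {k} (x ∷ᵥ v) b∈v =
  trans (isCOP-∷ x (v ∷ʳ _))
        (trans (cong ((toℕ x ≡ᵇ 0) ∧_) (every-cong k (occurs-∷ʳ-old (x ∷ᵥ v) b∈v))) (sym (isCOP-∷ x v)))

openers-∷ʳ-old : ∀ {k m} (v : Vec (Fin k) (suc m)) b → isCOP v ≡ true → openers (v ∷ʳ b) ≡ openers v
openers-∷ʳ-old {k} v b cop = begin
  openers (v ∷ʳ b)                                 ≡⟨ openers≡ (v ∷ʳ b) ⟩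
  map (λ c → firstPos c (v ∷ʳ b)) (allFin k)
    ≡⟨ map-cong (λ c → firstPos-∷ʳ c v b (isCOP⇒occurs v cop c)) (allFin k) ⟩
  map (λ c → firstPos c v) (allFin k)              ≡⟨ sym (openers≡ v) ⟩
  openers v                                        ∎
  where open ≡-Reasoning

¬occurs⇒¬isCOP : ∀ {k m} (v : Vec (Fin k) (suc m)) b → occurs b v ≡ false → isCOP v ≡ false
¬occurs⇒¬isCOP {k} (x ∷ᵥ v) b b∉v =
  trans (isCOP-∷ x v) (trans (cong ((toℕ x ≡ᵇ 0) ∧_) (every-false k _ b b∉v)) (∧-zeroʳ _))

occurs-punchIn : ∀ {K m} (b : Fin (suc K)) d (w : Vec (Fin K) m) → occurs (punchIn b d) (mapᵥ (punchIn b) w) ≡ occurs d w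
occurs-punchIn b d []ᵥ      = refl
occurs-punchIn b d (x ∷ᵥ w) = cong₂ _∨_ (finEq-injective (punchIn b) (punchIn-injective b _ _) x d) (occurs-punchIn b d w)

occurs-punchIn-self : ∀ {K m} (b : Fin (suc K)) (w : Vec (Fin K) m) → occurs b (mapᵥ (punchIn b) w) ≡ false
occurs-punchIn-self b []ᵥ      = refl
occurs-punchIn-self b (x ∷ᵥ w) = cong₂ _∨_ (finEq-false (punchInᵢ≢i b x)) (occurs-punchIn-self b w)

firstPos-punchIn : ∀ {K m} (b : Fin (suc K)) d (w : Vec (Fin K) m) →
                   firstPos (punchIn b d) (mapᵥ (punchIn b) w) ≡ firstPos d w
firstPos-punchIn b d []ᵥ      = refl
firstPos-punchIn b d (x ∷ᵥ w) rewrite finEq-injective (punchIn b) (punchIn-injective b _ _) x d with finEq x d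
... | true  = refl
... | false = cong bump (firstPos-punchIn b d w)

-- The new element m + 1 forms a singleton block, inserted at position b of the cyclic order.
withNewBlock : ∀ {K m} → Fin (suc K) → Vec (Fin K) m → Vec (Fin (suc K)) (suc m)
withNewBlock b w = mapᵥ (punchIn b) w ∷ʳ b

occurs-withNewBlock : ∀ {K m} (b : Fin (suc K)) (w : Vec (Fin K) m) d → occurs (punchIn b d) (withNewBlock b w) ≡ occurs d w
occurs-withNewBlock b w d = begin
  occurs (punchIn b d) (mapᵥ (punchIn b) w ∷ʳ b)
    ≡⟨ occurs-∷ʳ (punchIn b d) (mapᵥ (punchIn b) w) b ⟩
  occurs (punchIn b d) (mapᵥ (punchIn b) w) ∨ finEq b (punchIn b d)
    ≡⟨ cong₂ _∨_ (occurs-punchIn b d w) (finEq-false (punchInᵢ≢i b d ∘ sym)) ⟩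
  occurs d w ∨ false                                                ≡⟨ ∨-identityʳ _ ⟩
  occurs d w                                                        ∎
  where open ≡-Reasoning

isCOP-withNewBlock : ∀ {K m} (p : Fin K) (w : Vec (Fin K) (suc m)) → isCOP (withNewBlock (fsuc p) w) ≡ isCOP w
isCOP-withNewBlock {K} p (x ∷ᵥ w) = begin
  isCOP W
    ≡⟨ isCOP-∷ (punchIn b x) (withNewBlock b w) ⟩
  (toℕ (punchIn b x) ≡ᵇ 0) ∧ every (suc K) (λ c → occurs c W)
    ≡⟨ cong₂ _∧_ (first-block x) (every-punchIn K b (λ c → occurs c W)) ⟩
  (toℕ x ≡ᵇ 0) ∧ (occurs b W ∧ every K (λ d → occurs (punchIn b d) W))
    ≡⟨ cong ((toℕ x ≡ᵇ 0) ∧_) (cong₂ _∧_ b-occurs (every-cong K (occurs-withNewBlock b (x ∷ᵥ w)))) ⟩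
  (toℕ x ≡ᵇ 0) ∧ every K (λ d → occurs d (x ∷ᵥ w))
    ≡⟨ sym (isCOP-∷ x w) ⟩
  isCOP (x ∷ᵥ w) ∎
  where
  open ≡-Reasoning
  b = fsuc p
  V = mapᵥ (punchIn b) (x ∷ᵥ w)
  W = V ∷ʳ b
  first-block : ∀ x → (toℕ (punchIn b x) ≡ᵇ 0) ≡ (toℕ x ≡ᵇ 0)
  first-block fzero    = refl
  first-block (fsuc x) = refl
  b-occurs : occurs b W ≡ true
  b-occurs = trans (occurs-∷ʳ b V b) (trans (cong (occurs b V ∨_) (finEq-refl b)) (∨-zeroʳ (occurs b V)))

map-allFin-punchIn : ∀ K (b : Fin (suc K)) (g : Fin (suc K) → ℕ) →
  map g (allFin (suc K)) ≡ insertAt (toℕ b) (g b) (map (g ∘ punchIn b) (allFin K))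
map-allFin-punchIn K       fzero    g = map-allFin-suc K g
map-allFin-punchIn (suc K) (fsuc b) g = begin
  map g (allFin (suc (suc K)))                                              ≡⟨ map-allFin-suc (suc K) g ⟩
  g fzero ∷ map (g ∘ fsuc) (allFin (suc K))
    ≡⟨ cong (g fzero ∷_) (map-allFin-punchIn K b (g ∘ fsuc)) ⟩
  g fzero ∷ insertAt (toℕ b) (g (fsuc b)) (map (g ∘ fsuc ∘ punchIn b) (allFin K))
    ≡⟨ cong (insertAt (suc (toℕ b)) (g (fsuc b))) (sym (map-allFin-suc K _)) ⟩
  insertAt (suc (toℕ b)) (g (fsuc b)) (map (g ∘ punchIn (fsuc b)) (allFin (suc K))) ∎
  where open ≡-Reasoning

openers-withNewBlock : ∀ {K m} (b : Fin (suc K)) (w : Vec (Fin K) m) → (∀ d → occurs d w ≡ true) →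
  openers (withNewBlock b w) ≡ insertAt (toℕ b) (suc m) (openers w)
openers-withNewBlock {K} {m} b w w-onto = begin
  openers W                                                                  ≡⟨ openers≡ W ⟩
  map (λ c → firstPos c W) (allFin (suc K))
    ≡⟨ map-allFin-punchIn K b _ ⟩
  insertAt (toℕ b) (firstPos b W) (map (λ d → firstPos (punchIn b d) W) (allFin K))
    ≡⟨ cong₂ (insertAt (toℕ b)) (firstPos-∷ʳ-new (mapᵥ (punchIn b) w) b (occurs-punchIn-self b w))
                                (map-cong old (allFin K)) ⟩
  insertAt (toℕ b) (suc m) (map (λ d → firstPos d w) (allFin K))
    ≡⟨ cong (insertAt (toℕ b) (suc m)) (sym (openers≡ w)) ⟩
  insertAt (toℕ b) (suc m) (openers w)                                      ∎
  where
  open ≡-Reasoning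
  W = withNewBlock b w
  old : ∀ d → firstPos (punchIn b d) W ≡ firstPos d w
  old d = trans (firstPos-∷ʳ (punchIn b d) (mapᵥ (punchIn b) w) b (trans (occurs-punchIn b d w) (w-onto d)))
                (firstPos-punchIn b d w)

-- Removing the largest element

copTerm : ∀ {k m} → (List ℕ → ℕ) → Vec (Fin k) m → ℕ
copTerm φ v = ind (isCOP v) * φ (openers v)

copSum : ℕ → ℕ → (List ℕ → ℕ) → ℕ
copSum m k φ = ∑Vec m k (copTerm φ)

copTerm-∷ʳ : ∀ {k m} (φ : List ℕ → ℕ) (v : Vec (Fin k) (suc m)) b →
  copTerm φ (v ∷ʳ b) ≡ copTerm φ v + ind (not (occurs b v)) * copTerm φ (v ∷ʳ b)
copTerm-∷ʳ φ v b with occurs b v in b∈v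
... | true = trans old (sym (+-identityʳ _))
  where
  old : copTerm φ (v ∷ʳ b) ≡ copTerm φ v
  old rewrite isCOP-∷ʳ-old v b∈v with isCOP v in cop
  ... | false = refl
  ... | true  = cong (λ O → φ O + 0) (openers-∷ʳ-old v b cop)
... | false rewrite ¬occurs⇒¬isCOP v b b∈v = sym (+-identityʳ _)

∑-punchIn : ∀ K (b : Fin (suc K)) (g : Fin (suc K) → ℕ) →
  ∑[ c < suc K ] (ind (not (finEq c b)) * g c) ≡ ∑[ d < K ] g (punchIn b d)
∑-punchIn K       fzero    g = sum-cong-≗ (λ d → +-identityʳ (g (fsuc d)))
∑-punchIn (suc K) (fsuc b) g = cong₂ _+_ (+-identityʳ (g fzero)) (∑-punchIn K b (g ∘ fsuc))

∑Vec-avoiding : ∀ m K (b : Fin (suc K)) (f : Vec (Fin (suc K)) m → ℕ) →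
  ∑Vec m (suc K) (λ v → ind (not (occurs b v)) * f v) ≡ ∑Vec m K (λ w → f (mapᵥ (punchIn b) w))
∑Vec-avoiding zero    K b f = +-identityʳ (f []ᵥ)
∑Vec-avoiding (suc m) K b f = begin
  ∑Vec m (suc K) (λ v → ∑[ c < suc K ] (ind (not (finEq c b ∨ occurs b v)) * f (c ∷ᵥ v)))
    ≡⟨ ∑Vec-cong m (suc K) head ⟩
  ∑Vec m (suc K) (λ v → ind (not (occurs b v)) * ∑[ d < K ] f (punchIn b d ∷ᵥ v))
    ≡⟨ ∑Vec-avoiding m K b (λ v → ∑[ d < K ] f (punchIn b d ∷ᵥ v)) ⟩
  ∑Vec m K (λ w → ∑[ d < K ] f (punchIn b d ∷ᵥ mapᵥ (punchIn b) w)) ∎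
  where
  open ≡-Reasoning
  ind-not-∨ : ∀ a a′ → ind (not (a ∨ a′)) ≡ ind (not a′) * ind (not a)
  ind-not-∨ true  true  = refl
  ind-not-∨ true  false = refl
  ind-not-∨ false a′    = sym (*-identityʳ _)
  head : ∀ v → ∑[ c < suc K ] (ind (not (finEq c b ∨ occurs b v)) * f (c ∷ᵥ v))
             ≡ ind (not (occurs b v)) * ∑[ d < K ] f (punchIn b d ∷ᵥ v)
  head v = begin
    ∑[ c < suc K ] (ind (not (finEq c b ∨ occurs b v)) * f (c ∷ᵥ v))
      ≡⟨ sum-cong-≗ {suc K} (λ c → trans (cong (_* f (c ∷ᵥ v)) (ind-not-∨ (finEq c b) (occurs b v)))
                                        (*-assoc (ind (not (occurs b v))) (ind (not (finEq c b))) (f (c ∷ᵥ v)))) ⟩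
    ∑[ c < suc K ] (ind (not (occurs b v)) * (ind (not (finEq c b)) * f (c ∷ᵥ v)))
      ≡⟨ sym (*-distribˡ-sum (ind (not (occurs b v))) (λ c → ind (not (finEq c b)) * f (c ∷ᵥ v))) ⟩
    ind (not (occurs b v)) * ∑[ c < suc K ] (ind (not (finEq c b)) * f (c ∷ᵥ v))
      ≡⟨ cong (ind (not (occurs b v)) *_) (∑-punchIn K b (λ c → f (c ∷ᵥ v))) ⟩
    ind (not (occurs b v)) * ∑[ d < K ] f (punchIn b d ∷ᵥ v) ∎

copTerm-withNewBlock : ∀ {K m} (φ : List ℕ → ℕ) (p : Fin K) (w : Vec (Fin K) (suc m)) →
  copTerm φ (withNewBlock (fsuc p) w) ≡ ind (isCOP w) * φ (insertAt (suc (toℕ p)) (suc (suc m)) (openers w))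
copTerm-withNewBlock φ p w rewrite isCOP-withNewBlock p w with isCOP w in cop
... | false = refl
... | true  = cong (λ O → φ O + 0) (openers-withNewBlock (fsuc p) w (isCOP⇒occurs w cop))

copSum-split : ∀ m k φ → copSum (suc (suc m)) k φ
  ≡ k * copSum (suc m) k φ + ∑[ b < k ] ∑Vec (suc m) k (λ v → ind (not (occurs b v)) * copTerm φ (v ∷ʳ b))
copSum-split m k φ = begin
  copSum (suc (suc m)) k φ                                       ≡⟨ ∑Vec-∷ʳ (suc m) k (copTerm φ) ⟩
  ∑Vec (suc m) k (λ v → ∑[ b < k ] copTerm φ (v ∷ʳ b))
    ≡⟨ ∑Vec-cong (suc m) k (λ v → sum-cong-≗ {k} (copTerm-∷ʳ φ v)) ⟩
  ∑Vec (suc m) k (λ v → ∑[ b < k ] (copTerm φ v + N v b))        ≡⟨ ∑Vec-cong (suc m) k split ⟩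
  ∑Vec (suc m) k (λ v → k * copTerm φ v + ∑[ b < k ] N v b)
    ≡⟨ ∑Vec-+ (suc m) k (λ v → k * copTerm φ v) (λ v → ∑[ b < k ] N v b) ⟩
  ∑Vec (suc m) k (λ v → k * copTerm φ v) + ∑Vec (suc m) k (λ v → ∑[ b < k ] N v b)
    ≡⟨ cong₂ _+_ (∑Vec-*ˡ (suc m) k k (copTerm φ)) (∑Vec-comm (suc m) k k N) ⟩
  k * copSum (suc m) k φ + ∑[ b < k ] ∑Vec (suc m) k (λ v → N v b) ∎
  where
  open ≡-Reasoning
  N : Vec (Fin k) (suc m) → Fin k → ℕ
  N v b = ind (not (occurs b v)) * copTerm φ (v ∷ʳ b)
  split : ∀ v → ∑[ b < k ] (copTerm φ v + N v b) ≡ k * copTerm φ v + ∑[ b < k ] N v b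
  split v = trans (∑-distrib-+ (λ _ → copTerm φ v) (N v)) (cong (_+ ∑[ b < k ] N v b) (∑-const k (copTerm φ v)))

copSum-newBlocks : ∀ m K φ →
  ∑[ b < suc K ] ∑Vec (suc m) (suc K) (λ v → ind (not (occurs b v)) * copTerm φ (v ∷ʳ b))
  ≡ ∑Vec (suc m) K (λ w → ind (isCOP w) * ∑[ p < K ] φ (insertAt (suc (toℕ p)) (suc (suc m)) (openers w)))
copSum-newBlocks m K φ = begin
  ∑[ b < suc K ] ∑Vec (suc m) (suc K) (λ v → ind (not (occurs b v)) * copTerm φ (v ∷ʳ b))
    ≡⟨ sum-cong-≗ {suc K} (λ b → ∑Vec-avoiding (suc m) K b (λ v → copTerm φ (v ∷ʳ b))) ⟩
  ∑Vec (suc m) K (λ w → copTerm φ (withNewBlock fzero w))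
    + ∑[ p < K ] ∑Vec (suc m) K (λ w → copTerm φ (withNewBlock (fsuc p) w))
    ≡⟨ cong₂ _+_ (trans (∑Vec-cong (suc m) K first-block) (∑Vec-zero (suc m) K))
                 (sum-cong-≗ {K} (λ p → ∑Vec-cong (suc m) K (copTerm-withNewBlock φ p))) ⟩
  ∑[ p < K ] ∑Vec (suc m) K (λ w → ind (isCOP w) * φ (I p w))
    ≡⟨ sym (∑Vec-comm (suc m) K K (λ w p → ind (isCOP w) * φ (I p w))) ⟩
  ∑Vec (suc m) K (λ w → ∑[ p < K ] (ind (isCOP w) * φ (I p w)))
    ≡⟨ ∑Vec-cong (suc m) K (λ w → sym (*-distribˡ-sum (ind (isCOP w)) (λ p → φ (I p w)))) ⟩
  ∑Vec (suc m) K (λ w → ind (isCOP w) * ∑[ p < K ] φ (I p w)) ∎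
  where
  open ≡-Reasoning
  I : Fin K → Vec (Fin K) (suc m) → List ℕ
  I p w = insertAt (suc (toℕ p)) (suc (suc m)) (openers w)
  first-block : ∀ w → copTerm φ (withNewBlock fzero w) ≡ 0
  first-block (_ ∷ᵥ _) = refl

copSum-suc : ∀ m K φ → copSum (suc (suc m)) (suc K) φ
  ≡ suc K * copSum (suc m) (suc K) φ
    + ∑Vec (suc m) K (λ w → ind (isCOP w) * ∑[ p < K ] φ (insertAt (suc (toℕ p)) (suc (suc m)) (openers w)))
copSum-suc m K φ = trans (copSum-split m (suc K) φ) (cong (suc K * copSum (suc m) (suc K) φ +_) (copSum-newBlocks m K φ))

-- The recursion for the counts

maxAltLength-newOpener : ∀ {K m} (w : Vec (Fin (suc K)) (suc m)) → isCOP w ≡ true → ∀ (f : ℕ → ℕ) →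
  let L = maxAltLength (openers w) in
  ∑[ p < suc K ] f (maxAltLength (insertAt (suc (toℕ p)) (suc (suc m)) (openers w)))
  ≡ L * f L + (1 ⊓ K) * f (suc L) + (K ∸ L) * f (2 + L)
maxAltLength-newOpener {K} {m} w cop f =
  subst Claim (sym (openers-COP w cop))
    (subst (λ n → ∑[ p < suc n ] f (maxAltLength (1 ∷ insertAt (toℕ p) M r))
                  ≡ L * f L + (1 ⊓ n) * f (suc L) + (n ∸ L) * f (2 + L))
           (length-laterOpeners w)
           (maxAltLength-insertMax r M (s≤s (s≤s z≤n)) (laterOpeners-< w) (laterOpeners-pos w cop)
                                   (laterOpeners-unique w cop) f))
  where
  M = suc (suc m)
  r = laterOpeners w
  L = maxAltLength (1 ∷ r)
  Claim : List ℕ → Set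
  Claim O = let L = maxAltLength O in
            ∑[ p < suc K ] f (maxAltLength (insertAt (suc (toℕ p)) M O))
            ≡ L * f L + (1 ⊓ K) * f (suc L) + (K ∸ L) * f (2 + L)

altLengthIs : ℕ → List ℕ → ℕ
altLengthIs i O = ind (maxAltLength O ≡ᵇ i)

copCount : ℕ → ℕ → ℕ → ℕ
copCount m k i = copSum m k (altLengthIs i)

countCOP≡copCount : ∀ m k i → countCOP m k i ≡ copCount m k i
countCOP≡copCount m k i = begin
  countCOP m k i                                  ≡⟨ length-filterᵇ P (allVecs m k) ⟩
  List.sum (map (λ v → ind (P v)) (allVecs m k))  ≡⟨ sum-map-allVecs m k _ ⟩
  ∑Vec m k (λ v → ind (P v))                      ≡⟨ ∑Vec-cong m k (λ v → ind-∧ (isCOP v) _) ⟩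
  copCount m k i                                  ∎
  where
  open ≡-Reasoning
  P = λ v → isCOP v ∧ (maxAltLength (openers v) ≡ᵇ i)
  ind-∧ : ∀ a b → ind (a ∧ b) ≡ ind a * ind b
  ind-∧ true  b = sym (+-identityʳ (ind b))
  ind-∧ false b = refl

-- Contribution of the insertion positions that raise the alternation length by two.
raisedByTwo : ℕ → ℕ → ℕ → ℕ
raisedByTwo m K zero    = 0
raisedByTwo m K (suc a) = (K ∸ a) * copCount (suc m) (suc K) a

raisedByTwoWeight : ℕ → ℕ → ℕ → ℕ
raisedByTwoWeight K zero    L = 0
raisedByTwoWeight K (suc a) L = (K ∸ a) * ind (L ≡ᵇ a)

level-weights : ∀ K a L →
  L * ind (L ≡ᵇ suc a) + (1 ⊓ K) * ind (suc L ≡ᵇ suc a) + (K ∸ L) * ind (2 + L ≡ᵇ suc a)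
  ≡ suc a * ind (L ≡ᵇ suc a) + (1 ⊓ K) * ind (L ≡ᵇ a) + raisedByTwoWeight K a L
level-weights K a L = cong₂ _+_ (cong (_+ (1 ⊓ K) * ind (L ≡ᵇ a)) (*-ind-≡ᵇ (λ n → n) L (suc a))) (two a)
  where
  two : ∀ a → (K ∸ L) * ind (2 + L ≡ᵇ suc a) ≡ raisedByTwoWeight K a L
  two zero    = *-zeroʳ (K ∸ L)
  two (suc a) = *-ind-≡ᵇ (K ∸_) L a

newOpener-copTerm : ∀ {K m} a (w : Vec (Fin (suc K)) (suc m)) →
  ind (isCOP w) * ∑[ p < suc K ] altLengthIs (suc a) (insertAt (suc (toℕ p)) (suc (suc m)) (openers w))
  ≡ suc a * copTerm (altLengthIs (suc a)) w + (1 ⊓ K) * copTerm (altLengthIs a) w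
    + ind (isCOP w) * raisedByTwoWeight K a (maxAltLength (openers w))
newOpener-copTerm {K} {m} a w with isCOP w in cop
... | false = sym (cong₂ _+_ (cong₂ _+_ (*-zeroʳ (suc a)) (*-zeroʳ (1 ⊓ K))) refl)
... | true  = begin
  ∑[ p < suc K ] ind (maxAltLength (insertAt (suc (toℕ p)) (suc (suc m)) (openers w)) ≡ᵇ suc a) + 0
    ≡⟨ cong (_+ 0) (maxAltLength-newOpener w cop (λ n → ind (n ≡ᵇ suc a))) ⟩
  L * ind (L ≡ᵇ suc a) + (1 ⊓ K) * ind (suc L ≡ᵇ suc a) + (K ∸ L) * ind (2 + L ≡ᵇ suc a) + 0
    ≡⟨ cong (_+ 0) (level-weights K a L) ⟩
  suc a * ind (L ≡ᵇ suc a) + (1 ⊓ K) * ind (L ≡ᵇ a) + raisedByTwoWeight K a L + 0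
    ≡⟨ solve 5 (λ x y u v z → x :* u :+ y :* v :+ z :+ con 0 := x :* (u :+ con 0) :+ y :* (v :+ con 0) :+ (z :+ con 0))
             refl (suc a) (1 ⊓ K) (ind (L ≡ᵇ suc a)) (ind (L ≡ᵇ a)) (raisedByTwoWeight K a L) ⟩
  suc a * (ind (L ≡ᵇ suc a) + 0) + (1 ⊓ K) * (ind (L ≡ᵇ a) + 0) + (raisedByTwoWeight K a L + 0) ∎
  where
  open ≡-Reasoning
  L = maxAltLength (openers w)

copCount-suc : ∀ m K a → copCount (suc (suc m)) (suc (suc K)) (suc a)
  ≡ suc (suc K) * copCount (suc m) (suc (suc K)) (suc a)
    + (suc a * copCount (suc m) (suc K) (suc a) + (1 ⊓ K) * copCount (suc m) (suc K) a + raisedByTwo m K a)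
copCount-suc m K a =
  trans (copSum-suc m (suc K) (altLengthIs (suc a))) (cong (suc (suc K) * copCount (suc m) (suc (suc K)) (suc a) +_) (begin
  ∑Vec (suc m) (suc K) (λ w → ind (isCOP w) * ∑[ p < suc K ] altLengthIs (suc a) (I p w))
    ≡⟨ ∑Vec-cong (suc m) (suc K) (newOpener-copTerm a) ⟩
  ∑Vec (suc m) (suc K) (λ w → suc a * copTerm (altLengthIs (suc a)) w + (1 ⊓ K) * copTerm (altLengthIs a) w + R w)
    ≡⟨ ∑Vec-+ (suc m) (suc K) (λ w → suc a * copTerm (altLengthIs (suc a)) w + (1 ⊓ K) * copTerm (altLengthIs a) w) R ⟩
  ∑Vec (suc m) (suc K) (λ w → suc a * copTerm (altLengthIs (suc a)) w + (1 ⊓ K) * copTerm (altLengthIs a) w) + ∑Vec (suc m) (suc K) R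
    ≡⟨ cong₂ _+_ (trans (∑Vec-+ (suc m) (suc K) (λ w → suc a * copTerm (altLengthIs (suc a)) w) (λ w → (1 ⊓ K) * copTerm (altLengthIs a) w))
                        (cong₂ _+_ (∑Vec-*ˡ (suc m) (suc K) (suc a) (copTerm (altLengthIs (suc a))))
                                   (∑Vec-*ˡ (suc m) (suc K) (1 ⊓ K) (copTerm (altLengthIs a)))))
                 (raised a) ⟩
  suc a * copCount (suc m) (suc K) (suc a) + (1 ⊓ K) * copCount (suc m) (suc K) a + raisedByTwo m K a ∎))
  where
  open ≡-Reasoning
  I : Fin (suc K) → Vec (Fin (suc K)) (suc m) → List ℕ
  I p w = insertAt (suc (toℕ p)) (suc (suc m)) (openers w)
  R : Vec (Fin (suc K)) (suc m) → ℕ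
  R w = ind (isCOP w) * raisedByTwoWeight K a (maxAltLength (openers w))
  raised : ∀ a → ∑Vec (suc m) (suc K) (λ w → ind (isCOP w) * raisedByTwoWeight K a (maxAltLength (openers w)))
                 ≡ raisedByTwo m K a
  raised zero    = trans (∑Vec-cong (suc m) (suc K) (λ w → *-zeroʳ (ind (isCOP w)))) (∑Vec-zero (suc m) (suc K))
  raised (suc a) = trans (∑Vec-cong (suc m) (suc K) (λ w → trans (sym (*-assoc (ind (isCOP w)) (K ∸ a) (altLengthIs a (openers w))))
                                                         (trans (cong (_* altLengthIs a (openers w)) (*-comm (ind (isCOP w)) (K ∸ a)))
                                                                (*-assoc (K ∸ a) (ind (isCOP w)) (altLengthIs a (openers w))))))
                         (∑Vec-*ˡ (suc m) (suc K) (K ∸ a) (copTerm (altLengthIs a)))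

copCount-zeroLength : ∀ m K → copCount (suc m) (suc K) 0 ≡ 0
copCount-zeroLength m K = trans (∑Vec-cong (suc m) (suc K) term) (∑Vec-zero (suc m) (suc K))
  where
  term : ∀ w → copTerm (altLengthIs 0) w ≡ 0
  term w with isCOP w in cop
  ... | false = refl
  ... | true  = trans (cong (λ O → ind (maxAltLength O ≡ᵇ 0) + 0) (openers-COP w cop))
                      (cong (λ n → ind (n ≡ᵇ 0) + 0) (maxAltLength-∷ 1 (laterOpeners w)))

copCount-full : ∀ m a → copCount (suc m) (suc (suc a)) (suc (suc a)) ≡ 0
copCount-full m a = trans (∑Vec-cong (suc m) (suc (suc a)) term) (∑Vec-zero (suc m) (suc (suc a)))
  where
  greedy-< : ∀ r → length r ≡ suc a → All (1 ≤_) r → greedy true 1 r < suc a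
  greedy-< (y ∷ ys) len (1≤y ∷ _) rewrite ≥⇒<ᵇ-false y 1 1≤y =
    s≤s (subst (greedy true y ys ≤_) (suc-injective len) (greedy-≤-length true y ys))
  term : ∀ w → copTerm (altLengthIs (suc (suc a))) w ≡ 0
  term w with isCOP w in cop
  ... | false = refl
  ... | true  = trans (cong (λ O → ind (maxAltLength O ≡ᵇ suc (suc a)) + 0) (openers-COP w cop))
                      (trans (cong (λ n → ind (n ≡ᵇ suc (suc a)) + 0) (maxAltLength-∷ 1 (laterOpeners w)))
                             (cong (_+ 0) (ind-≡ᵇ-< (greedy-< r (length-laterOpeners w) (laterOpeners-pos w cop)))))
    where r = laterOpeners w

copCount-oneBlock : ∀ m → copCount (suc m) 1 1 ≡ 1
copCount-oneBlock zero    = refl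
copCount-oneBlock (suc m) =
  trans (copSum-suc m 0 (altLengthIs 1))
        (cong₂ _+_ (trans (+-identityʳ _) (copCount-oneBlock m)) (∑Vec-zero m 0))

copCount-singleton : ∀ k i → copCount 1 (suc (suc k)) i ≡ 0
copCount-singleton k i = trans (sum-cong-≗ {suc (suc k)} term) (trans (∑-const (suc (suc k)) 0) (*-zeroʳ (suc (suc k))))
  where
  term : ∀ b → copTerm (altLengthIs i) (b ∷ᵥ []ᵥ) ≡ 0
  term fzero    = refl
  term (fsuc b) = refl

module LowerTerms (n : ℕ) (ih : ∀ a j → T n (suc a) j ≡ copCount (suc n) (suc (suc a + j)) (suc a)) where

  p : Polyℕ
  p = (Dℕ^ n) wℕ

  T-x⁰ : ∀ j → T n 0 (suc j) ≡ (1 ⊓ suc j) * copCount (suc n) (suc (suc j)) 0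
  T-x⁰ j = trans (T-x⁰y⁺ n j) (sym (cong (_+ 0) (copCount-zeroLength n (suc j))))

  T-x⁺ : ∀ a j → T n (suc a) j ≡ (1 ⊓ (suc a + j)) * copCount (suc n) (suc (suc a + j)) (suc a)
  T-x⁺ a j = trans (ih a j) (sym (+-identityʳ _))

  xyPart-y⁺ : ∀ a j → xyPart p a (suc j) ≡ suc a * copCount (suc n) (suc (a + suc j)) (suc a)
  xyPart-y⁺ a j = cong (suc a *_) (trans (ih a j) (cong (λ k → copCount (suc n) (suc k) (suc a)) (sym (+-suc a j))))

  xyPart-y⁰ : ∀ a → xyPart p (suc a) 0 ≡ suc (suc a) * copCount (suc n) (suc (suc a + 0)) (suc (suc a))
  xyPart-y⁰ a = sym (trans (cong (λ k → suc (suc a) * copCount (suc n) (suc k) (suc (suc a))) (+-identityʳ (suc a)))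
                           (trans (cong (suc (suc a) *_) (copCount-full n a)) (*-zeroʳ (suc (suc a)))))

  x²Part≡raisedByTwo : ∀ a j → x²Part p a j ≡ raisedByTwo n (a + j) a
  x²Part≡raisedByTwo zero    j = refl
  x²Part≡raisedByTwo (suc a) j = cong₂ _*_ (sym (trans (cong (_∸ a) (sym (+-suc a j))) (m+n∸m≡n a (suc j)))) (lower a)
    where
    lower : ∀ a → T n a (suc j) ≡ copCount (suc n) (suc (suc a + j)) a
    lower zero    = trans (T-x⁰y⁺ n j) (sym (copCount-zeroLength n (suc j)))
    lower (suc a) = trans (ih a (suc j)) (cong (λ k → copCount (suc n) (suc k) (suc a)) (+-suc (suc a) j))

  lowerTerms : ∀ a j → T n a j + xyPart p a j + x²Part p a j
    ≡ suc a * copCount (suc n) (suc (a + j)) (suc a) + (1 ⊓ (a + j)) * copCount (suc n) (suc (a + j)) a + raisedByTwo n (a + j) a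
  lowerTerms zero    zero    rewrite T-x⁰y⁰ n | copCount-oneBlock n = refl
  lowerTerms zero    (suc j) = cong₂ _+_ (trans (+-comm (T n 0 (suc j)) _) (cong₂ _+_ (xyPart-y⁺ 0 j) (T-x⁰ j))) refl
  lowerTerms (suc a) zero    = cong₂ _+_ (trans (+-comm (T n (suc a) 0) 0) (cong₂ _+_ (xyPart-y⁰ a) (T-x⁺ a 0)))
                                         (x²Part≡raisedByTwo (suc a) zero)
  lowerTerms (suc a) (suc j) = cong₂ _+_ (trans (+-comm (T n (suc a) (suc j)) _)
                                                (cong₂ _+_ (xyPart-y⁺ (suc a) j) (T-x⁺ a (suc j))))
                                         (x²Part≡raisedByTwo (suc a) (suc j))

T≡copCount : ∀ n a j → T n (suc a) j ≡ copCount (suc n) (suc (suc a + j)) (suc a)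
T≡copCount zero    a j = sym (copCount-singleton (a + j) (suc a))
T≡copCount (suc n) a j = begin
  T (suc n) (suc a) j
    ≡⟨ Dℕ-x⁺ p a j ⟩
  (2 + a + j) * T n (suc a) j + (T n a j + xyPart p a j + x²Part p a j)
    ≡⟨ cong₂ _+_ (cong ((2 + a + j) *_) (T≡copCount n a j)) (lowerTerms a j) ⟩
  (2 + a + j) * copCount (suc n) (2 + a + j) (suc a)
    + (suc a * copCount (suc n) (suc (a + j)) (suc a) + (1 ⊓ (a + j)) * copCount (suc n) (suc (a + j)) a + raisedByTwo n (a + j) a)
    ≡⟨ sym (copCount-suc n (a + j) a) ⟩
  copCount (suc (suc n)) (2 + a + j) (suc a) ∎
  where
  open ≡-Reasoning
  open LowerTerms n (T≡copCount n)

corollary3 : (n i j : ℕ) → n ≥ 1 → i ≥ 1 →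
  t n i j ≡ ℕtoℚ (countCOP (n + 1) (i + j + 1) i)
corollary3 n (suc a) j _ _ = begin
  t n (suc a) j
    ≡⟨ t≡T n (suc a) j ⟩
  ℕtoℚ (T n (suc a) j)
    ≡⟨ cong ℕtoℚ (T≡copCount n a j) ⟩
  ℕtoℚ (copCount (1 + n) (1 + (suc a + j)) (suc a))
    ≡⟨ cong ℕtoℚ (sym (countCOP≡copCount (1 + n) _ (suc a))) ⟩
  ℕtoℚ (countCOP (1 + n) (1 + (suc a + j)) (suc a))
    ≡⟨ cong₂ (λ m k → ℕtoℚ (countCOP m k (suc a))) (+-comm 1 n) (+-comm 1 (suc a + j)) ⟩
  ℕtoℚ (countCOP (n + 1) (suc a + j + 1) (suc a)) ∎
  where open ≡-Reasoning
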